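{- Let $m\ge n\ge 0$ be integers, $\lambda$ a partition inside the $n\times m$ board, and $k=\ell(\lambda)$. Then \[ \binom{m-k}{n-k}_q H^{m+n-k}_k(\lambda)=q^{k(n-k)}\,[m+n-2k]_{m-k}\,H^{m,n}_k(\lambda), \] and for every $0\le r<k$, \[ \binom{m-r}{n-r}_q H^{m+n-r-1}_r(\lambda)=q^{r(n-r-1)}[m+n-2r-1]_{m-r-1}H^{m,n}_r(\lambda)+\sum_{j=r+1}^n q^{r(n-1-j)}\binom{j}{r}_q\frac{[m+n-r-j-1]_{m-r}}{[n-r]}H^{m,n}_j(\lambda). \] Here $\lambda$ is viewed inside the square boards of sizes $m+n-k$ and $m+n-r-1$.
   Context: $q$ is an indeterminate; $[x]=(1-q^x)/(1-q)$, $[n]_k=[n][n-1]\cdots[n-k+1]$ ($[n]_0=1$), $[n]!=[n]_n$, $\binom nk_q=[n]_k/[k]!$, $(a;q)_k=\prod_{i=0}^{k-1}(1-aq^i)$. A partition $\lambda$ is identified with its Ferrers board (rows from the top, columns from the left, row $i$ having $\lambda_i$ cells); $|\lambda|$ is its number of cells; $\lambda$ is inside the $n\times m$ board if $\ell(\lambda)\le n$, $\lambda_1\le m$. $R_k(\lambda)=\sum_p q^{\mathrm{inv}(p)}$ over placements of $k$ non-attacking rooks on $\lambda$, with $\mathrm{inv}(p)$ the number of cells of $\lambda$ having no rook and neither to the left of a rook in the same row nor above a rook in the same column. For $M\ge N$ and $\lambda$ inside the $N\times M$ board, $H^{M,N}_i(\lambda)$ ($0\le i\le N$) are defined by $\sum_{i=0}^N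 H^{M,N}_i(\lambda)x^i=\frac{q^{ -|\lambda|}}{[M-N]!}\sum_{i=0}^N R_i(\lambda)[M-i]!(-1)^iq^{Mi-\binom i2}(x;q)_i$; $H^{N}_i(\lambda):=H^{N,N}_i(\lambda)$. -}

module Defs where

open import Level using (Level; _⊔_) renaming (suc to lsuc)
open import Algebra.Bundles using (CommutativeRing)
open import Data.Nat as ℕ using (ℕ; zero; suc; _∸_; _≤_; _<ᵇ_; _≡ᵇ_)
open import Data.Integer as ℤ using (ℤ; +_; -[1+_])
open import Data.Bool using (Bool; true; false; not; _∧_; _∨_; if_then_else_)
import Data.Nat.ListAction
open import Data.Maybe using (Maybe; just; nothing)
open import Data.List using (List; []; _∷_; map; length; foldr; applyUpTo; upTo; concatMap; filter)
open import Data.List.Relation.Unary.All using (All)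
open import Data.Product using (_×_)
open import Relation.Nullary.Decidable using (Dec; yes; no)
open import Data.Bool using (T)

-- Partitions (as lists of positive, weakly decreasing row lengths, top row first)

data Decreasing : List ℕ → Set where
  dec-[]  : Decreasing []
  dec-one : ∀ {a} → Decreasing (a ∷ [])
  dec-∷   : ∀ {a b l} → b ≤ a → Decreasing (b ∷ l) → Decreasing (a ∷ b ∷ l)

IsPartition : List ℕ → Set
IsPartition λ′ = All (λ a → 1 ≤ a) λ′ × Decreasing λ′

len : List ℕ → ℕ
len = length

size : List ℕ → ℕ
size = Data.Nat.ListAction.sum

InsideBoard : ℕ → ℕ → List ℕ → Set
InsideBoard n m λ′ = len λ′ ≤ n × All (λ a → a ≤ m) λ′

-- Rook placements on a Ferrers board.
-- A placement is a list with one entry per row: nothing (no rook) or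
-- just c (a rook in column c, 0-based, c < λ_i).

Placement : Set
Placement = List (Maybe ℕ)

rowChoices : ℕ → List (Maybe ℕ)
rowChoices a = nothing ∷ map just (upTo a)

allPlacements : List ℕ → List Placement
allPlacements []        = []  ∷ []
allPlacements (a ∷ λ′)  = concatMap (λ e → map (e ∷_) (allPlacements λ′)) (rowChoices a)

colUsed : ℕ → Placement → Bool
colUsed c []              = false
colUsed c (nothing ∷ p)   = colUsed c p
colUsed c (just c′ ∷ p)   = (c ≡ᵇ c′) ∨ colUsed c p

nonAttacking : Placement → Bool
nonAttacking []             = true
nonAttacking (nothing ∷ p)  = nonAttacking p
nonAttacking (just c ∷ p)   = not (colUsed c p) ∧ nonAttacking p

rooks : Placement → ℕ
rooks []             = 0
rooks (nothing ∷ p)  = rooks p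
rooks (just _ ∷ p)   = suc (rooks p)

count : List Bool → ℕ
count []            = 0
count (true ∷ bs)   = suc (count bs)
count (false ∷ bs)  = count bs

-- cell (row, column c) with row entry e and the entries p of all rows below:
-- it counts for inv iff it holds no rook, is not left of a rook in its row
-- (i.e. e is nothing or a rook in a column c′ < c), and is not above a rook
-- in its column (no lower row has a rook in column c).
cellCounts : Maybe ℕ → Placement → ℕ → Bool
cellCounts nothing   below c = not (colUsed c below)
cellCounts (just c′) below c = (c′ <ᵇ c) ∧ not (colUsed c below)

inv : List ℕ → Placement → ℕ
inv (a ∷ λ′) (e ∷ p) = count (map (cellCounts e p) (upTo a)) ℕ.+ inv λ′ p
inv _        _       = 0

placements : ℕ → List ℕ → List Placement
placements k λ′ = filter (λ p → T? (nonAttacking p ∧ (rooks p ≡ᵇ k))) (allPlacements λ′)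
  where
  T? : (b : Bool) → Dec (T b)
  T? true  = yes _
  T? false = no (λ ())

-- The coefficient ring.  q is an indeterminate; all identities live in
-- Z[q, q⁻¹, 1/[j] (j ≥ 1)] ⊂ ℚ(q).  We state them in an arbitrary commutative
-- ring with an element q in which q and every [j] (j ≥ 1) are invertible
-- (the universal such ring is the one above, so this is equivalent).

module RingOps {c ℓ} (R : CommutativeRing c ℓ) where
  open CommutativeRing R
  pow : Carrier → ℕ → Carrier
  pow x zero    = 1#
  pow x (suc n) = x * pow x n

  qintAt : Carrier → ℕ → Carrier
  qintAt q zero    = 0#
  qintAt q (suc n) = 1# + q * qintAt q n

record QSetting (c ℓ : Level) : Set (lsuc (c ⊔ ℓ)) where
  field
    cring : CommutativeRing c ℓ
  open CommutativeRing cring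
  open RingOps cring
  field
    q       : Carrier
    qinv    : Carrier
    q-inv   : q * qinv ≈ 1#
    bracketInv   : ℕ → Carrier
    bracket-inv  : ∀ j → qintAt q (suc j) * bracketInv j ≈ 1#

module QOps {c ℓ} (S : QSetting c ℓ) where
  open QSetting S public
  open CommutativeRing cring public
  open RingOps cring public

  qint : ℕ → Carrier
  qint = qintAt q

  qpowℤ : ℤ → Carrier
  qpowℤ (+ n)     = pow q n
  qpowℤ -[1+ n ]  = pow qinv (suc n)

  prod : List Carrier → Carrier
  prod = foldr _*_ 1#

  sumC : List Carrier → Carrier
  sumC = foldr _+_ 0#

  sumRange : ℕ → ℕ → (ℕ → Carrier) → Carrier
  sumRange a b f = sumC (applyUpTo (λ t → f (a ℕ.+ t)) (suc b ∸ a))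

  qfall : ℕ → ℕ → Carrier
  qfall n k = prod (applyUpTo (λ t → qint (n ∸ t)) k)

  qfact : ℕ → Carrier
  qfact n = qfall n n

  qfactInv : ℕ → Carrier
  qfactInv n = prod (applyUpTo bracketInv n)

  -- [n]⁻¹ for n ≥ 1 (only used for n ≥ 1)
  qintInv : ℕ → Carrier
  qintInv zero    = 0#
  qintInv (suc n) = bracketInv n

  qbinom : ℕ → ℕ → Carrier
  qbinom n k = qfall n k * qfactInv k

  R : ℕ → List ℕ → Carrier
  R k λ′ = sumC (map (λ p → pow q (inv λ′ p)) (placements k λ′))

  -- polynomials in x: coefficient lists (constant term first)
  Poly : Set c
  Poly = List Carrier

  _⊕_ : Poly → Poly → Poly
  []       ⊕ p′       = p′
  (a ∷ p)  ⊕ []       = a ∷ p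
  (a ∷ p)  ⊕ (b ∷ p′) = (a + b) ∷ (p ⊕ p′)

  scale : Carrier → Poly → Poly
  scale a = map (a *_)

  mulLin : Carrier → Poly → Poly
  mulLin a p = p ⊕ (0# ∷ scale (- a) p)

  xqPoch : ℕ → Poly
  xqPoch zero    = 1# ∷ []
  xqPoch (suc i) = mulLin (pow q i) (xqPoch i)

  coeff : Poly → ℕ → Carrier
  coeff []       _       = 0#
  coeff (a ∷ p)  zero    = a
  coeff (a ∷ p)  (suc i) = coeff p i

  binom2 : ℕ → ℕ
  binom2 i = (i ℕ.* (i ∸ 1)) ℕ./ 2

  -- Σ_{i=0}^{N} R_i(λ) [M-i]! (-1)^i q^{Mi - C(i,2)} (x;q)_i
  -- (for 0 ≤ i ≤ N ≤ M the exponent Mi - C(i,2) is ≥ 0)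
  Hgen : ℕ → ℕ → List ℕ → Poly
  Hgen M N λ′ = foldr _⊕_ [] (applyUpTo
    (λ i → scale (R i λ′ * qfact (M ∸ i) * pow (- 1#) i * pow q (M ℕ.* i ∸ binom2 i)) (xqPoch i))
    (suc N))

  H : ℕ → ℕ → ℕ → List ℕ → Carrier
  H M N i λ′ = pow qinv (size λ′) * qfactInv (M ∸ N) * coeff (Hgen M N λ′) i

  Hsq : ℕ → ℕ → List ℕ → Carrier
  Hsq N i λ′ = H N N i λ′

module Submission where

-- Unfolding the definition, H^{M,N}_i(λ) = q^{-|λ|}/[M-N]! Σ_{t ≤ ℓ(λ)} R_t(λ) K_M(i,t) with
-- K_M(i,t) = [M-t]! (-1)^t q^{Mt-C(t,2)} (-1)^i q^{C(i,2)} [t choose i] (the q-binomial theorem for (x;q)_t;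
-- R_t(λ) = 0 for t > ℓ(λ) because rooks sit in distinct rows). Both identities are linear in the rook numbers,
-- so it suffices to prove them kernel by kernel, for each t ≤ ℓ(λ). In the first only t = k contributes and
-- what remains is an identity between q-factorials. In the second, writing t = r + J, the trinomial revision
-- [t choose j][j choose r] = [t choose r][J choose j-r] factors out everything except the J-th q-difference
-- Σ_s (-1)^s q^{C(s,2)} [J choose s] [c-s]_a of a falling factorial, and this equals q^{J(c-a)} [a]_J [c-J]_{a-J}
-- by induction on J through the q-Pascal rule.

open import Defs
open import Data.Nat as ℕ using (ℕ; zero; suc; _∸_; _≤_; _<_; z≤n; s≤s)
import Data.Nat.Properties as NP
import Data.Nat.DivMod as DM
import Data.Nat.Divisibility as ND
import Data.Nat.Tactic.RingSolver as NS
open import Data.List using (List; []; _∷_; applyUpTo; foldr; map; concatMap)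
open import Data.List.Relation.Unary.All as All using (All; []; _∷_)
import Data.List.Relation.Unary.All.Properties as AllP
import Data.List.Properties as LP
open import Data.Maybe using (just; nothing)
open import Data.Bool using (true; T; _∧_)
open import Data.Empty using (⊥)
open import Data.Integer as ℤ using (+_)
import Data.Integer.Properties as ZP
open import Data.Product using (_×_; _,_)
open import Data.Sum using (inj₁; inj₂)
open import Relation.Binary.PropositionalEquality as P using (_≡_)
open import Algebra.Bundles using (CommutativeRing)
import Algebra.Solver.Ring.NaturalCoefficients.Default as NCS
import Algebra.Properties.Ring as RingProperties
import Algebra.Properties.CommutativeSemigroup as CommutativeSemigroupProperties
import Relation.Binary.Reasoning.Setoid as SetoidReasoning

m+n≡o⇒o∸m≡n : ∀ m {n o} → m ℕ.+ n ≡ o → o ∸ m ≡ n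
m+n≡o⇒o∸m≡n m {n} P.refl = NP.m+n∸m≡n m n

allPlacements-rooks≤len : ∀ lam → All (λ p → rooks p ≤ len lam) (allPlacements lam)
allPlacements-rooks≤len []        = z≤n ∷ []
allPlacements-rooks≤len (a ∷ lam) = extend (rowChoices a) (allPlacements-rooks≤len lam)
  where
  cons : ∀ e {ps} → All (λ p → rooks p ≤ len lam) ps → All (λ p → rooks p ≤ suc (len lam)) (map (e ∷_) ps)
  cons e        []       = []
  cons nothing  (h ∷ hs) = NP.m≤n⇒m≤1+n h ∷ cons nothing hs
  cons (just _) (h ∷ hs) = s≤s h ∷ cons (just _) hs
  extend : ∀ es {ps} → All (λ p → rooks p ≤ len lam) ps →
           All (λ p → rooks p ≤ suc (len lam)) (concatMap (λ e → map (e ∷_) ps) es)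
  extend []       hs = []
  extend (e ∷ es) hs = AllP.++⁺ (cons e hs) (extend es hs)

placements-len< : ∀ {t} lam → len lam < t → placements t lam ≡ []
placements-len< {t} lam len<t = LP.filter-none _ (All.map (λ {p} → excluded {p}) (allPlacements-rooks≤len lam))
  where
  excluded : ∀ {p} → rooks p ≤ len lam → T (nonAttacking p ∧ (rooks p ℕ.≡ᵇ t)) → ⊥
  excluded {p} rooks≤ valid with nonAttacking p
  ... | true = NP.<-irrefl P.refl
    (NP.<-≤-trans len<t (P.subst (ℕ._≤ len lam) (NP.≡ᵇ⇒≡ (rooks p) t valid) rooks≤))

module CommutativeRingLemmas {c ℓ} (R : CommutativeRing c ℓ) where
  open CommutativeRing R
  open RingOps R using (pow)
  open RingProperties ring using (-1*x≈-x)
  open CommutativeSemigroupProperties *-commutativeSemigroup public using (interchange)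
  open NCS commutativeSemiring using (solve; _:=_; _:+_)
  open SetoidReasoning setoid

  pow-+ : ∀ x a b → pow x (a ℕ.+ b) ≈ pow x a * pow x b
  pow-+ x zero    b = sym (*-identityˡ _)
  pow-+ x (suc a) b = trans (*-congˡ (pow-+ x a b)) (sym (*-assoc _ _ _))

  x+-1x≈0 : ∀ x → x + - 1# * x ≈ 0#
  x+-1x≈0 x = trans (+-congˡ (-1*x≈-x x)) (-‿inverseʳ x)

  *-cancelʳ-unit : ∀ {x y u v} → u * v ≈ 1# → x * u ≈ y * u → x ≈ y
  *-cancelʳ-unit {x} {y} {u} {v} uv≈1 xu≈yu = begin
    x                ≈⟨ *-identityʳ x ⟨
    x * 1#           ≈⟨ *-congˡ uv≈1 ⟨
    x * (u * v)      ≈⟨ *-assoc x u v ⟨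
    (x * u) * v      ≈⟨ *-congʳ xu≈yu ⟩
    (y * u) * v      ≈⟨ *-assoc y u v ⟩
    y * (u * v)      ≈⟨ *-congˡ uv≈1 ⟩
    y * 1#           ≈⟨ *-identityʳ y ⟩
    y                ∎

  unit-* : ∀ {u v u′ v′} → u * v ≈ 1# → u′ * v′ ≈ 1# → (u * u′) * (v * v′) ≈ 1#
  unit-* {u} {v} {u′} {v′} uv≈1 u′v′≈1 = begin
    (u * u′) * (v * v′)  ≈⟨ interchange u u′ v v′ ⟩
    (u * v) * (u′ * v′)  ≈⟨ *-cong uv≈1 u′v′≈1 ⟩
    1# * 1#              ≈⟨ *-identityˡ 1# ⟩
    1#                   ∎

  ∑ : ℕ → (ℕ → Carrier) → Carrier
  ∑ n g = foldr _+_ 0# (applyUpTo g n)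

  ∏ : ℕ → (ℕ → Carrier) → Carrier
  ∏ n g = foldr _*_ 1# (applyUpTo g n)

  ∑-cong : ∀ n {g h} → (∀ t → t < n → g t ≈ h t) → ∑ n g ≈ ∑ n h
  ∑-cong zero    g≈h = refl
  ∑-cong (suc n) g≈h = +-cong (g≈h 0 (s≤s z≤n)) (∑-cong n (λ t t<n → g≈h (suc t) (s≤s t<n)))

  ∑-zero : ∀ n {g} → (∀ t → t < n → g t ≈ 0#) → ∑ n g ≈ 0#
  ∑-zero zero    g≈0 = refl
  ∑-zero (suc n) g≈0 =
    trans (+-cong (g≈0 0 (s≤s z≤n)) (∑-zero n (λ t t<n → g≈0 (suc t) (s≤s t<n)))) (+-identityˡ 0#)

  ∑-+ : ∀ n g h → ∑ n (λ t → g t + h t) ≈ ∑ n g + ∑ n h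
  ∑-+ zero    g h = sym (+-identityˡ 0#)
  ∑-+ (suc n) g h = trans (+-congˡ (∑-+ n (λ t → g (suc t)) (λ t → h (suc t))))
    (solve 4 (λ a b c d → (a :+ b) :+ (c :+ d) := (a :+ c) :+ (b :+ d)) refl
      (g 0) (h 0) (∑ n (λ t → g (suc t))) (∑ n (λ t → h (suc t))))

  ∑-*ˡ : ∀ n x g → x * ∑ n g ≈ ∑ n (λ t → x * g t)
  ∑-*ˡ zero    x g = zeroʳ x
  ∑-*ˡ (suc n) x g = trans (distribˡ x _ _) (+-congˡ (∑-*ˡ n x (λ t → g (suc t))))

  ∑-++ : ∀ n d g → ∑ (n ℕ.+ d) g ≈ ∑ n g + ∑ d (λ u → g (n ℕ.+ u))
  ∑-++ zero    d g = sym (+-identityˡ _)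
  ∑-++ (suc n) d g = trans (+-congˡ (∑-++ n d (λ t → g (suc t)))) (sym (+-assoc _ _ _))

  ∑-snoc : ∀ n g → ∑ (suc n) g ≈ ∑ n g + g n
  ∑-snoc n g = begin
    ∑ (suc n) g                  ≡⟨ P.cong (λ z → ∑ z g) (NP.+-comm 1 n) ⟩
    ∑ (n ℕ.+ 1) g                ≈⟨ ∑-++ n 1 g ⟩
    ∑ n g + (g (n ℕ.+ 0) + 0#)   ≈⟨ +-congˡ (+-identityʳ _) ⟩
    ∑ n g + g (n ℕ.+ 0)          ≡⟨ P.cong (λ z → ∑ n g + g z) (NP.+-identityʳ n) ⟩
    ∑ n g + g n                  ∎

  ∑-comm : ∀ a b (f : ℕ → ℕ → Carrier) → ∑ a (λ i → ∑ b (f i)) ≈ ∑ b (λ j → ∑ a (λ i → f i j))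
  ∑-comm zero    b f = sym (∑-zero b (λ _ _ → refl))
  ∑-comm (suc a) b f = trans (+-congˡ (∑-comm a b (λ i → f (suc i))))
    (sym (∑-+ b (f 0) (λ j → ∑ a (λ i → f (suc i) j))))

  ∑-truncate : ∀ k N g → k ≤ N → (∀ t → k < t → g t ≈ 0#) → ∑ (suc N) g ≈ ∑ (suc k) g
  ∑-truncate k N g k≤N g≈0 with NP.m≤n⇒∃[o]m+o≡n k≤N
  ... | d , P.refl = begin
    ∑ (suc k ℕ.+ d) g
      ≈⟨ ∑-++ (suc k) d g ⟩
    ∑ (suc k) g + ∑ d (λ u → g (suc k ℕ.+ u))
      ≈⟨ +-congˡ (∑-zero d (λ u _ → g≈0 (suc k ℕ.+ u) (s≤s (NP.m≤m+n k u)))) ⟩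
    ∑ (suc k) g + 0#
      ≈⟨ +-identityʳ _ ⟩
    ∑ (suc k) g ∎

  ∏-cong : ∀ n {g h} → (∀ t → g t ≈ h t) → ∏ n g ≈ ∏ n h
  ∏-cong zero    g≈h = refl
  ∏-cong (suc n) g≈h = *-cong (g≈h 0) (∏-cong n (λ t → g≈h (suc t)))

  ∏-snoc : ∀ n g → ∏ (suc n) g ≈ ∏ n g * g n
  ∏-snoc zero    g = trans (*-identityʳ _) (sym (*-identityˡ _))
  ∏-snoc (suc n) g = trans (*-congˡ (∏-snoc n (λ t → g (suc t)))) (sym (*-assoc _ _ _))

module Binom2Properties {c ℓ} (S : QSetting c ℓ) where
  open QOps S using (binom2)
  open P.≡-Reasoning

  binom2-suc : ∀ i → binom2 (suc i) ≡ binom2 i ℕ.+ i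
  binom2-suc zero    = P.refl
  binom2-suc (suc i) = begin
    (suc (suc i) ℕ.* suc i) ℕ./ 2                 ≡⟨ P.cong (ℕ._/ 2) (split i) ⟩
    (suc i ℕ.* i ℕ.+ suc i ℕ.* 2) ℕ./ 2           ≡⟨ DM.+-distrib-/-∣ʳ (suc i ℕ.* i) (ND.divides-refl (suc i)) ⟩
    binom2 (suc i) ℕ.+ (suc i ℕ.* 2) ℕ./ 2        ≡⟨ P.cong (binom2 (suc i) ℕ.+_) (DM.m*n/n≡m (suc i) 2) ⟩
    binom2 (suc i) ℕ.+ suc i                      ∎
    where
    split : ∀ i → suc (suc i) ℕ.* suc i ≡ suc i ℕ.* i ℕ.+ suc i ℕ.* 2
    split = NS.solve-∀

  binom2-+ : ∀ r s → binom2 (r ℕ.+ s) ≡ binom2 r ℕ.+ binom2 s ℕ.+ r ℕ.* s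
  binom2-+ r zero    = P.trans (P.cong binom2 (NP.+-identityʳ r)) (rearrange r (binom2 r))
    where
    rearrange : ∀ r b → b ≡ b ℕ.+ 0 ℕ.+ r ℕ.* 0
    rearrange = NS.solve-∀
  binom2-+ r (suc s) = begin
    binom2 (r ℕ.+ suc s)
      ≡⟨ P.cong binom2 (NP.+-suc r s) ⟩
    binom2 (suc (r ℕ.+ s))
      ≡⟨ binom2-suc (r ℕ.+ s) ⟩
    binom2 (r ℕ.+ s) ℕ.+ (r ℕ.+ s)
      ≡⟨ P.cong (ℕ._+ (r ℕ.+ s)) (binom2-+ r s) ⟩
    binom2 r ℕ.+ binom2 s ℕ.+ r ℕ.* s ℕ.+ (r ℕ.+ s)
      ≡⟨ rearrange r s (binom2 r) (binom2 s) ⟩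
    binom2 r ℕ.+ (binom2 s ℕ.+ s) ℕ.+ r ℕ.* suc s
      ≡⟨ P.cong (λ z → binom2 r ℕ.+ z ℕ.+ r ℕ.* suc s) (binom2-suc s) ⟨
    binom2 r ℕ.+ binom2 (suc s) ℕ.+ r ℕ.* suc s ∎
    where
    rearrange : ∀ r s a b → a ℕ.+ b ℕ.+ r ℕ.* s ℕ.+ (r ℕ.+ s) ≡ a ℕ.+ (b ℕ.+ s) ℕ.+ r ℕ.* suc s
    rearrange = NS.solve-∀

  binom2≤* : ∀ M t → t ≤ M → binom2 t ≤ M ℕ.* t
  binom2≤* M t t≤M = NP.≤-trans (DM.m/n≤m (t ℕ.* (t ∸ 1)) 2)
    (NP.≤-trans (NP.*-monoʳ-≤ t (NP.≤-trans (NP.m∸n≤m t 1) t≤M)) (NP.≤-reflexive (NP.*-comm t M)))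

module QCalculus {c ℓ} (S : QSetting c ℓ) where
  open QOps S hiding (zero)
  open CommutativeRingLemmas cring
  open Binom2Properties S
  open NCS commutativeSemiring using (solve; _:=_; _:+_; _:*_; con)
  open SetoidReasoning setoid

  -1# : Carrier
  -1# = - 1#

  qint-+ : ∀ x y → qint (x ℕ.+ y) ≈ qint x + pow q x * qint y
  qint-+ zero    y = sym (trans (+-identityˡ _) (*-identityˡ _))
  qint-+ (suc x) y = begin
    1# + q * qint (x ℕ.+ y)
      ≈⟨ +-congˡ (*-congˡ (qint-+ x y)) ⟩
    1# + q * (qint x + pow q x * qint y)
      ≈⟨ solve 5 (λ o a b c d → o :+ a :* (b :+ c :* d) := (o :+ a :* b) :+ (a :* c) :* d)
           refl 1# q (qint x) (pow q x) (qint y) ⟩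
    (1# + q * qint x) + (q * pow q x) * qint y ∎

  qfall-suc : ∀ n k → qfall n (suc k) ≈ qint n * qfall (n ∸ 1) k
  qfall-suc n k = *-congˡ (∏-cong k (λ t → reflexive (P.cong qint (P.sym (NP.∸-+-assoc n 1 t)))))

  qfall-snoc : ∀ n k → qfall n (suc k) ≈ qfall n k * qint (n ∸ k)
  qfall-snoc n k = ∏-snoc k (λ t → qint (n ∸ t))

  qfall-+ : ∀ n a b → qfall n (a ℕ.+ b) ≈ qfall n a * qfall (n ∸ a) b
  qfall-+ n zero    b = sym (*-identityˡ _)
  qfall-+ n (suc a) b = begin
    qfall n (suc (a ℕ.+ b))
      ≈⟨ qfall-suc n (a ℕ.+ b) ⟩
    qint n * qfall (n ∸ 1) (a ℕ.+ b)
      ≈⟨ *-congˡ (qfall-+ (n ∸ 1) a b) ⟩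
    qint n * (qfall (n ∸ 1) a * qfall (n ∸ 1 ∸ a) b)
      ≈⟨ *-assoc _ _ _ ⟨
    (qint n * qfall (n ∸ 1) a) * qfall (n ∸ 1 ∸ a) b
      ≈⟨ *-congʳ (qfall-suc n a) ⟨
    qfall n (suc a) * qfall (n ∸ 1 ∸ a) b
      ≡⟨ P.cong (λ z → qfall n (suc a) * qfall z b) (NP.∸-+-assoc n 1 a) ⟩
    qfall n (suc a) * qfall (n ∸ suc a) b ∎

  qfall-vanish : ∀ n k → n < k → qfall n k ≈ 0#
  qfall-vanish n k n<k with NP.m≤n⇒∃[o]m+o≡n n<k
  ... | d , P.refl = begin
    qfall n (suc n ℕ.+ d)
      ≈⟨ qfall-+ n (suc n) d ⟩
    qfall n (suc n) * qfall (n ∸ suc n) d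
      ≈⟨ *-congʳ (qfall-snoc n n) ⟩
    (qfall n n * qint (n ∸ n)) * qfall (n ∸ suc n) d
      ≡⟨ P.cong (λ z → (qfall n n * qint z) * qfall (n ∸ suc n) d) (NP.n∸n≡0 n) ⟩
    (qfall n n * 0#) * qfall (n ∸ suc n) d
      ≈⟨ *-congʳ (zeroʳ _) ⟩
    0# * qfall (n ∸ suc n) d
      ≈⟨ zeroˡ _ ⟩
    0# ∎

  qfact-suc : ∀ k → qfact (suc k) ≈ qint (suc k) * qfact k
  qfact-suc k = qfall-suc (suc k) k

  qfact*qfactInv : ∀ k → qfact k * qfactInv k ≈ 1#
  qfact*qfactInv zero    = *-identityˡ 1#
  qfact*qfactInv (suc k) = begin
    qfact (suc k) * qfactInv (suc k)
      ≈⟨ *-cong (qfact-suc k) (∏-snoc k bracketInv) ⟩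
    (qint (suc k) * qfact k) * (qfactInv k * bracketInv k)
      ≈⟨ solve 4 (λ a b c d → (a :* b) :* (c :* d) := (a :* d) :* (b :* c))
           refl (qint (suc k)) (qfact k) (qfactInv k) (bracketInv k) ⟩
    (qint (suc k) * bracketInv k) * (qfact k * qfactInv k)
      ≈⟨ *-cong (bracket-inv k) (qfact*qfactInv k) ⟩
    1# * 1#
      ≈⟨ *-identityˡ 1# ⟩
    1# ∎

  qfactInv*qfact : ∀ k → qfactInv k * qfact k ≈ 1#
  qfactInv*qfact k = trans (*-comm _ _) (qfact*qfactInv k)

  qbinom*qfact : ∀ n k → qbinom n k * qfact k ≈ qfall n k
  qbinom*qfact n k = begin
    (qfall n k * qfactInv k) * qfact k    ≈⟨ *-assoc _ _ _ ⟩
    qfall n k * (qfactInv k * qfact k)    ≈⟨ *-congˡ (qfactInv*qfact k) ⟩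
    qfall n k * 1#                        ≈⟨ *-identityʳ _ ⟩
    qfall n k                             ∎

  qbinom-zeroʳ : ∀ n → qbinom n 0 ≈ 1#
  qbinom-zeroʳ n = *-identityˡ 1#

  qbinom-vanish : ∀ n k → n < k → qbinom n k ≈ 0#
  qbinom-vanish n k n<k = trans (*-congʳ (qfall-vanish n k n<k)) (zeroˡ _)

  qfall*qfact : ∀ n k → k ≤ n → qfall n k * qfact (n ∸ k) ≈ qfact n
  qfall*qfact n k k≤n = begin
    qfall n k * qfall (n ∸ k) (n ∸ k)   ≈⟨ qfall-+ n k (n ∸ k) ⟨
    qfall n (k ℕ.+ (n ∸ k))             ≡⟨ P.cong (qfall n) (NP.m+[n∸m]≡n k≤n) ⟩
    qfall n n                           ∎

  qfall*qfactInv : ∀ a b → b ≤ a → qfall a b * qfactInv a ≈ qfactInv (a ∸ b)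
  qfall*qfactInv a b b≤a = *-cancelʳ-unit (qfact*qfactInv (a ∸ b)) (begin
    qfall a b * qfactInv a * qfact (a ∸ b)     ≈⟨ solve 3 (λ x y z → x :* y :* z := x :* z :* y) refl _ _ _ ⟩
    qfall a b * qfact (a ∸ b) * qfactInv a     ≈⟨ *-congʳ (qfall*qfact a b b≤a) ⟩
    qfact a * qfactInv a                       ≈⟨ qfact*qfactInv a ⟩
    1#                                         ≈⟨ qfactInv*qfact (a ∸ b) ⟨
    qfactInv (a ∸ b) * qfact (a ∸ b)           ∎)

  qfact*qfactInv-+ : ∀ a b → qfact (a ℕ.+ b) * qfactInv b ≈ qfall (a ℕ.+ b) a
  qfact*qfactInv-+ a b = begin
    qfact (a ℕ.+ b) * qfactInv b
      ≈⟨ *-congʳ (qfall*qfact (a ℕ.+ b) a (NP.m≤m+n a b)) ⟨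
    qfall (a ℕ.+ b) a * qfact (a ℕ.+ b ∸ a) * qfactInv b
      ≡⟨ P.cong (λ z → qfall (a ℕ.+ b) a * qfact z * qfactInv b) (NP.m+n∸m≡n a b) ⟩
    qfall (a ℕ.+ b) a * qfact b * qfactInv b
      ≈⟨ *-assoc _ _ _ ⟩
    qfall (a ℕ.+ b) a * (qfact b * qfactInv b)
      ≈⟨ *-congˡ (qfact*qfactInv b) ⟩
    qfall (a ℕ.+ b) a * 1#
      ≈⟨ *-identityʳ _ ⟩
    qfall (a ℕ.+ b) a ∎

  qbinom*qfact*qfactInv : ∀ a b → b ≤ a → qbinom a b * qfact (a ℕ.+ b) * qfactInv a ≈ qfall (a ℕ.+ b) a * qfactInv (a ∸ b)
  qbinom*qfact*qfactInv a b b≤a = begin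
    qfall a b * qfactInv b * qfact (a ℕ.+ b) * qfactInv a
      ≈⟨ solve 4 (λ f i f′ i′ → f :* i :* f′ :* i′ := (f :* i′) :* (f′ :* i)) refl _ _ _ _ ⟩
    (qfall a b * qfactInv a) * (qfact (a ℕ.+ b) * qfactInv b)
      ≈⟨ *-cong (qfall*qfactInv a b b≤a) (qfact*qfactInv-+ a b) ⟩
    qfactInv (a ∸ b) * qfall (a ℕ.+ b) a
      ≈⟨ *-comm _ _ ⟩
    qfall (a ℕ.+ b) a * qfactInv (a ∸ b) ∎

  qfall≈qfact*qfactInv : ∀ n k → k ≤ n → qfall n k ≈ qfact n * qfactInv (n ∸ k)
  qfall≈qfact*qfactInv n k k≤n = *-cancelʳ-unit (qfact*qfactInv (n ∸ k)) (begin
    qfall n k * qfact (n ∸ k)                         ≈⟨ qfall*qfact n k k≤n ⟩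
    qfact n                                           ≈⟨ *-identityʳ _ ⟨
    qfact n * 1#                                      ≈⟨ *-congˡ (qfactInv*qfact (n ∸ k)) ⟨
    qfact n * (qfactInv (n ∸ k) * qfact (n ∸ k))      ≈⟨ *-assoc _ _ _ ⟨
    qfact n * qfactInv (n ∸ k) * qfact (n ∸ k)        ∎)

  qfact*qfactInv-suc : ∀ b → qfact b * qfactInv (suc b) ≈ bracketInv b
  qfact*qfactInv-suc b = begin
    qfact b * qfactInv (suc b)               ≈⟨ *-congˡ (∏-snoc b bracketInv) ⟩
    qfact b * (qfactInv b * bracketInv b)    ≈⟨ *-assoc _ _ _ ⟨
    qfact b * qfactInv b * bracketInv b      ≈⟨ *-congʳ (qfact*qfactInv b) ⟩
    1# * bracketInv b                        ≈⟨ *-identityˡ _ ⟩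
    bracketInv b                             ∎

  qfall-pascal₁ : ∀ n k → qfall (suc n) (suc k) ≈ pow q (suc k) * qfall n (suc k) + qint (suc k) * qfall n k
  qfall-pascal₁ n k with NP.≤-<-connex k n
  ... | inj₂ n<k = begin
    qfall (suc n) (suc k)
      ≈⟨ qfall-vanish (suc n) (suc k) (s≤s n<k) ⟩
    0#
      ≈⟨ trans (+-cong (zeroʳ _) (zeroʳ _)) (+-identityˡ 0#) ⟨
    pow q (suc k) * 0# + qint (suc k) * 0#
      ≈⟨ +-cong (*-congˡ (qfall-vanish n (suc k) (NP.m<n⇒m<1+n n<k)))
           (*-congˡ (qfall-vanish n k n<k)) ⟨
    pow q (suc k) * qfall n (suc k) + qint (suc k) * qfall n k ∎
  ... | inj₁ k≤n with NP.m≤n⇒∃[o]m+o≡n k≤n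
  ... | d , P.refl = begin
    qint (suc (k ℕ.+ d)) * qfall (k ℕ.+ d) k
      ≈⟨ *-congʳ (qint-+ (suc k) d) ⟩
    (qint (suc k) + pow q (suc k) * qint d) * qfall (k ℕ.+ d) k
      ≈⟨ solve 4 (λ a b c f → (a :+ b :* c) :* f := b :* (f :* c) :+ a :* f)
           refl (qint (suc k)) (pow q (suc k)) (qint d) (qfall (k ℕ.+ d) k) ⟩
    pow q (suc k) * (qfall (k ℕ.+ d) k * qint d) + qint (suc k) * qfall (k ℕ.+ d) k
      ≡⟨ P.cong (λ z → pow q (suc k) * (qfall (k ℕ.+ d) k * qint z) + qint (suc k) * qfall (k ℕ.+ d) k) (NP.m+n∸m≡n k d) ⟨
    pow q (suc k) * (qfall (k ℕ.+ d) k * qint (k ℕ.+ d ∸ k)) + qint (suc k) * qfall (k ℕ.+ d) k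
      ≈⟨ +-congʳ (*-congˡ (qfall-snoc (k ℕ.+ d) k)) ⟨
    pow q (suc k) * qfall (k ℕ.+ d) (suc k) + qint (suc k) * qfall (k ℕ.+ d) k ∎

  qfall-pascal₂ : ∀ n k → pow q k * qfall (suc n) (suc k) ≈ pow q k * qfall n (suc k) + pow q n * (qint (suc k) * qfall n k)
  qfall-pascal₂ n k with NP.≤-<-connex k n
  ... | inj₂ n<k = begin
    pow q k * qfall (suc n) (suc k)
      ≈⟨ *-congˡ (qfall-vanish (suc n) (suc k) (s≤s n<k)) ⟩
    pow q k * 0#
      ≈⟨ zeroʳ _ ⟩
    0#
      ≈⟨ trans (+-cong (zeroʳ _) (trans (*-congˡ (zeroʳ _)) (zeroʳ _))) (+-identityˡ 0#) ⟨
    pow q k * 0# + pow q n * (qint (suc k) * 0#)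
      ≈⟨ +-cong (*-congˡ (qfall-vanish n (suc k) (NP.m<n⇒m<1+n n<k)))
           (*-congˡ (*-congˡ (qfall-vanish n k n<k))) ⟨
    pow q k * qfall n (suc k) + pow q n * (qint (suc k) * qfall n k) ∎
  ... | inj₁ k≤n with NP.m≤n⇒∃[o]m+o≡n k≤n
  ... | d , P.refl = begin
    pow q k * (qint (suc (k ℕ.+ d)) * F)
      ≡⟨ P.cong (λ z → pow q k * (qint z * F)) (P.trans (P.cong suc (NP.+-comm k d)) (P.sym (NP.+-suc d k))) ⟩
    pow q k * (qint (d ℕ.+ suc k) * F)
      ≈⟨ *-congˡ (*-congʳ (qint-+ d (suc k))) ⟩
    pow q k * ((qint d + pow q d * qint (suc k)) * F)
      ≈⟨ solve 5 (λ a b c g f → a :* ((b :+ c :* g) :* f) := a :* (f :* b) :+ (a :* c) :* (g :* f))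
           refl (pow q k) (qint d) (pow q d) (qint (suc k)) F ⟩
    pow q k * (F * qint d) + (pow q k * pow q d) * (qint (suc k) * F)
      ≡⟨ P.cong (λ z → pow q k * (F * qint z) + (pow q k * pow q d) * (qint (suc k) * F)) (NP.m+n∸m≡n k d) ⟨
    pow q k * (F * qint (k ℕ.+ d ∸ k)) + (pow q k * pow q d) * (qint (suc k) * F)
      ≈⟨ +-cong (*-congˡ (qfall-snoc (k ℕ.+ d) k)) (*-congʳ (pow-+ q k d)) ⟨
    pow q k * qfall (k ℕ.+ d) (suc k) + pow q (k ℕ.+ d) * (qint (suc k) * F) ∎
    where
    F = qfall (k ℕ.+ d) k

  qbinom-pascal : ∀ n k → qbinom (suc n) (suc k) ≈ pow q (suc k) * qbinom n (suc k) + qbinom n k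
  qbinom-pascal n k = *-cancelʳ-unit (qfact*qfactInv (suc k)) (begin
    qbinom (suc n) (suc k) * qfact (suc k)
      ≈⟨ qbinom*qfact (suc n) (suc k) ⟩
    qfall (suc n) (suc k)
      ≈⟨ qfall-pascal₁ n k ⟩
    pow q (suc k) * qfall n (suc k) + qint (suc k) * qfall n k
      ≈⟨ +-cong (*-congˡ (qbinom*qfact n (suc k))) (*-congˡ (qbinom*qfact n k)) ⟨
    pow q (suc k) * (qbinom n (suc k) * qfact (suc k)) + qint (suc k) * (qbinom n k * qfact k)
      ≈⟨ +-congˡ (solve 3 (λ I B′ f → I :* (B′ :* f) := B′ :* (I :* f)) refl _ _ _) ⟩
    pow q (suc k) * (qbinom n (suc k) * qfact (suc k)) + qbinom n k * (qint (suc k) * qfact k)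
      ≈⟨ +-congˡ (*-congˡ (qfact-suc k)) ⟨
    pow q (suc k) * (qbinom n (suc k) * qfact (suc k)) + qbinom n k * qfact (suc k)
      ≈⟨ solve 4 (λ Q B B′ F → Q :* (B :* F) :+ B′ :* F := (Q :* B :+ B′) :* F)
           refl (pow q (suc k)) (qbinom n (suc k)) (qbinom n k) (qfact (suc k)) ⟩
    (pow q (suc k) * qbinom n (suc k) + qbinom n k) * qfact (suc k) ∎)

  pow-binom2-suc : ∀ i → pow q (binom2 (suc i)) ≈ pow q (binom2 i) * pow q i
  pow-binom2-suc i = trans (reflexive (P.cong (pow q) (binom2-suc i))) (pow-+ q (binom2 i) i)

  qbinom-trinomial : ∀ t j r → r ≤ j → qbinom t j * qbinom j r ≈ qbinom t r * qbinom (t ∸ r) (j ∸ r)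
  qbinom-trinomial t j r r≤j = *-cancelʳ-unit (unit-* (qfact*qfactInv r) (qfact*qfactInv (j ∸ r))) (begin
    qbinom t j * qbinom j r * (qfact r * qfact (j ∸ r))
      ≈⟨ solve 4 (λ a b c d → a :* b :* (c :* d) := a :* (b :* c :* d)) refl _ _ _ _ ⟩
    qbinom t j * (qbinom j r * qfact r * qfact (j ∸ r))
      ≈⟨ *-congˡ (trans (*-congʳ (qbinom*qfact j r)) (qfall*qfact j r r≤j)) ⟩
    qbinom t j * qfact j
      ≈⟨ qbinom*qfact t j ⟩
    qfall t j
      ≡⟨ P.cong (qfall t) (NP.m+[n∸m]≡n r≤j) ⟨
    qfall t (r ℕ.+ (j ∸ r))
      ≈⟨ qfall-+ t r (j ∸ r) ⟩
    qfall t r * qfall (t ∸ r) (j ∸ r)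
      ≈⟨ *-cong (qbinom*qfact t r) (qbinom*qfact (t ∸ r) (j ∸ r)) ⟨
    (qbinom t r * qfact r) * (qbinom (t ∸ r) (j ∸ r) * qfact (j ∸ r))
      ≈⟨ interchange _ _ _ _ ⟩
    qbinom t r * qbinom (t ∸ r) (j ∸ r) * (qfact r * qfact (j ∸ r)) ∎)

  coeff-⊕ : ∀ p p′ i → coeff (p ⊕ p′) i ≈ coeff p i + coeff p′ i
  coeff-⊕ []      p′       i       = sym (+-identityˡ _)
  coeff-⊕ (a ∷ p) []       i       = sym (+-identityʳ _)
  coeff-⊕ (a ∷ p) (b ∷ p′) zero    = refl
  coeff-⊕ (a ∷ p) (b ∷ p′) (suc i) = coeff-⊕ p p′ i

  coeff-scale : ∀ a p i → coeff (scale a p) i ≈ a * coeff p i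
  coeff-scale a []      i       = sym (zeroʳ a)
  coeff-scale a (b ∷ p) zero    = refl
  coeff-scale a (b ∷ p) (suc i) = coeff-scale a p i

  coeff-foldr-⊕ : ∀ n (F : ℕ → Poly) i → coeff (foldr _⊕_ [] (applyUpTo F n)) i ≈ ∑ n (λ t → coeff (F t) i)
  coeff-foldr-⊕ zero    F i = refl
  coeff-foldr-⊕ (suc n) F i = trans (coeff-⊕ (F 0) _ i) (+-congˡ (coeff-foldr-⊕ n (λ t → F (suc t)) i))

  coeff-mulLin-zero : ∀ a p → coeff (mulLin a p) 0 ≈ coeff p 0
  coeff-mulLin-zero a p = trans (coeff-⊕ p _ 0) (+-identityʳ _)

  coeff-mulLin-suc : ∀ a p i → coeff (mulLin a p) (suc i) ≈ coeff p (suc i) + -1# * (a * coeff p i)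
  coeff-mulLin-suc a p i = trans (coeff-⊕ p _ (suc i)) (+-congˡ (begin
    coeff (scale (- a) p) i    ≈⟨ coeff-scale (- a) p i ⟩
    - a * coeff p i            ≈⟨ *-congʳ (-1*x≈-x a) ⟨
    -1# * a * coeff p i        ≈⟨ *-assoc _ _ _ ⟩
    -1# * (a * coeff p i)      ∎))
    where open RingProperties ring using (-1*x≈-x)

  coeff-xqPoch*qfact : ∀ t i → coeff (xqPoch t) i * qfact i ≈ pow -1# i * pow q (binom2 i) * qfall t i
  coeff-xqPoch*qfact zero    zero    = trans (*-identityˡ 1#) (sym (trans (*-identityʳ _) (*-identityˡ _)))
  coeff-xqPoch*qfact zero    (suc i) = trans (zeroˡ _) (sym (trans (*-congˡ (qfall-vanish 0 (suc i) (s≤s z≤n))) (zeroʳ _)))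
  coeff-xqPoch*qfact (suc t) zero    = trans (*-congʳ (coeff-mulLin-zero (pow q t) (xqPoch t))) (coeff-xqPoch*qfact t zero)
  coeff-xqPoch*qfact (suc t) (suc i) = begin
    coeff (mulLin (pow q t) (xqPoch t)) (suc i) * qfact (suc i)
      ≈⟨ *-cong (coeff-mulLin-suc (pow q t) (xqPoch t) i) (qfact-suc i) ⟩
    (cᵢ₊₁ + -1# * (pow q t * cᵢ)) * (qint (suc i) * qfact i)
      ≈⟨ solve 6 (λ a E Q b I F → (a :+ E :* (Q :* b)) :* (I :* F) := a :* (I :* F) :+ E :* Q :* I :* (b :* F))
           refl cᵢ₊₁ -1# (pow q t) cᵢ (qint (suc i)) (qfact i) ⟩
    cᵢ₊₁ * (qint (suc i) * qfact i) + -1# * pow q t * qint (suc i) * (cᵢ * qfact i)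
      ≈⟨ +-cong (trans (*-congˡ (sym (qfact-suc i))) (coeff-xqPoch*qfact t (suc i))) (*-congˡ (coeff-xqPoch*qfact t i)) ⟩
    pow -1# (suc i) * pow q (binom2 (suc i)) * qfall t (suc i)
      + -1# * pow q t * qint (suc i) * (pow -1# i * pow q (binom2 i) * qfall t i)
      ≈⟨ +-congʳ (*-congʳ (*-congˡ (pow-binom2-suc i))) ⟩
    pow -1# (suc i) * (pow q (binom2 i) * pow q i) * qfall t (suc i)
      + -1# * pow q t * qint (suc i) * (pow -1# i * pow q (binom2 i) * qfall t i)
      ≈⟨ solve 8 (λ E σ Q qi A qt I B → E :* σ :* (Q :* qi) :* A :+ E :* qt :* I :* (σ :* Q :* B)
                                      := E :* σ :* Q :* (qi :* A :+ qt :* (I :* B)))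
           refl -1# (pow -1# i) (pow q (binom2 i)) (pow q i) (qfall t (suc i)) (pow q t) (qint (suc i)) (qfall t i) ⟩
    -1# * pow -1# i * pow q (binom2 i) * (pow q i * qfall t (suc i) + pow q t * (qint (suc i) * qfall t i))
      ≈⟨ *-congˡ (qfall-pascal₂ t i) ⟨
    -1# * pow -1# i * pow q (binom2 i) * (pow q i * qfall (suc t) (suc i))
      ≈⟨ solve 5 (λ E σ Q qi A → E :* σ :* Q :* (qi :* A) := E :* σ :* (Q :* qi) :* A)
           refl -1# (pow -1# i) (pow q (binom2 i)) (pow q i) (qfall (suc t) (suc i)) ⟩
    pow -1# (suc i) * (pow q (binom2 i) * pow q i) * qfall (suc t) (suc i)
      ≈⟨ *-congʳ (*-congˡ (pow-binom2-suc i)) ⟨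
    pow -1# (suc i) * pow q (binom2 (suc i)) * qfall (suc t) (suc i) ∎
    where
    cᵢ   = coeff (xqPoch t) i
    cᵢ₊₁ = coeff (xqPoch t) (suc i)

  coeff-xqPoch : ∀ t i → coeff (xqPoch t) i ≈ pow -1# i * pow q (binom2 i) * qbinom t i
  coeff-xqPoch t i = *-cancelʳ-unit (qfact*qfactInv i) (begin
    coeff (xqPoch t) i * qfact i                         ≈⟨ coeff-xqPoch*qfact t i ⟩
    pow -1# i * pow q (binom2 i) * qfall t i             ≈⟨ *-congˡ (qbinom*qfact t i) ⟨
    pow -1# i * pow q (binom2 i) * (qbinom t i * qfact i) ≈⟨ *-assoc _ _ _ ⟨
    pow -1# i * pow q (binom2 i) * qbinom t i * qfact i  ∎)

  Δ-weight : ℕ → ℕ → Carrier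
  Δ-weight J s = pow -1# s * pow q (binom2 s) * qbinom J s

  Δ : ℕ → (ℕ → Carrier) → Carrier
  Δ J f = ∑ (suc J) (λ s → Δ-weight J s * f s)

  Δ-cong : ∀ J {f g} → (∀ s → s ≤ J → f s ≈ g s) → Δ J f ≈ Δ J g
  Δ-cong J {f} {g} f≈g = ∑-cong (suc J) {λ s → Δ-weight J s * f s} {λ s → Δ-weight J s * g s}
       (λ s s<1+J → *-congˡ (f≈g s (NP.≤-pred s<1+J)))

  Δ-*ˡ : ∀ J x f → x * Δ J f ≈ Δ J (λ s → x * f s)
  Δ-*ˡ J x f = trans (∑-*ˡ (suc J) x (λ s → Δ-weight J s * f s))
    (∑-cong (suc J) {λ s → x * (Δ-weight J s * f s)} {λ s → Δ-weight J s * (x * f s)}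
      (λ s _ → solve 3 (λ A k F → k :* (A :* F) := A :* (k :* F)) refl (Δ-weight J s) x (f s)))

  Δ-suc : ∀ J f → Δ (suc J) f ≈ Δ J (λ s → pow q s * (f s + -1# * f (suc s)))
  Δ-suc J f = begin
    g 0 + ∑ (suc J) (λ s → g (suc s))
      ≈⟨ +-cong g0≈h₁0 (∑-cong (suc J) (λ s _ → pascal s)) ⟩
    h₁ 0 + ∑ (suc J) (λ s → h₁ (suc s) + -1# * h₂ s)
      ≈⟨ +-congˡ (trans (∑-+ (suc J) (λ s → h₁ (suc s)) (λ s → -1# * h₂ s)) (+-congˡ (sym (∑-*ˡ (suc J) -1# h₂)))) ⟩
    h₁ 0 + (∑ (suc J) (λ s → h₁ (suc s)) + -1# * ∑ (suc J) h₂)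
      ≈⟨ +-assoc _ _ _ ⟨
    ∑ (suc (suc J)) h₁ + -1# * ∑ (suc J) h₂
      ≈⟨ +-congʳ (trans (∑-snoc (suc J) h₁) (trans (+-congˡ h₁-top) (+-identityʳ _))) ⟩
    ∑ (suc J) h₁ + -1# * ∑ (suc J) h₂
      ≈⟨ +-congˡ (∑-*ˡ (suc J) -1# h₂) ⟩
    ∑ (suc J) h₁ + ∑ (suc J) (λ s → -1# * h₂ s)
      ≈⟨ ∑-+ (suc J) h₁ (λ s → -1# * h₂ s) ⟨
    ∑ (suc J) (λ s → h₁ s + -1# * h₂ s)
      ≈⟨ ∑-cong (suc J) (λ s _ → regroup s) ⟩
    Δ J (λ s → pow q s * (f s + -1# * f (suc s))) ∎
    where
    a : ℕ → Carrier
    a s = pow -1# s * pow q (binom2 s)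
    g h₁ h₂ : ℕ → Carrier
    g  s = a s * qbinom (suc J) s * f s
    h₁ s = a s * pow q s * qbinom J s * f s
    h₂ s = a s * pow q s * qbinom J s * f (suc s)
    g0≈h₁0 : g 0 ≈ h₁ 0
    g0≈h₁0 = *-congʳ (trans (*-congˡ (qbinom-zeroʳ (suc J))) (sym (trans (*-congˡ (qbinom-zeroʳ J)) (*-identityʳ _))))
    h₁-top : h₁ (suc J) ≈ 0#
    h₁-top = trans (*-congʳ (trans (*-congˡ (qbinom-vanish J (suc J) (NP.n<1+n J))) (zeroʳ _))) (zeroˡ _)
    pascal : ∀ s → g (suc s) ≈ h₁ (suc s) + -1# * h₂ s
    pascal s = begin
      a (suc s) * qbinom (suc J) (suc s) * f (suc s)
        ≈⟨ *-congʳ (*-congˡ (qbinom-pascal J s)) ⟩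
      a (suc s) * (pow q (suc s) * qbinom J (suc s) + qbinom J s) * f (suc s)
        ≈⟨ solve 5 (λ A qs B B′ F → A :* (qs :* B :+ B′) :* F := A :* qs :* B :* F :+ A :* B′ :* F)
             refl (a (suc s)) (pow q (suc s)) (qbinom J (suc s)) (qbinom J s) (f (suc s)) ⟩
      h₁ (suc s) + pow -1# (suc s) * pow q (binom2 (suc s)) * qbinom J s * f (suc s)
        ≈⟨ +-congˡ (*-congʳ (*-congʳ (*-congˡ (pow-binom2-suc s)))) ⟩
      h₁ (suc s) + -1# * pow -1# s * (pow q (binom2 s) * pow q s) * qbinom J s * f (suc s)
        ≈⟨ +-congˡ (solve 6 (λ E σ Q qs B F → E :* σ :* (Q :* qs) :* B :* F := E :* (σ :* Q :* qs :* B :* F))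
             refl -1# (pow -1# s) (pow q (binom2 s)) (pow q s) (qbinom J s) (f (suc s))) ⟩
      h₁ (suc s) + -1# * h₂ s ∎
    regroup : ∀ s → h₁ s + -1# * h₂ s ≈ a s * qbinom J s * (pow q s * (f s + -1# * f (suc s)))
    regroup s = solve 6 (λ A qs B F E F′ → A :* qs :* B :* F :+ E :* (A :* qs :* B :* F′) := A :* B :* (qs :* (F :+ E :* F′)))
      refl (a s) (pow q s) (qbinom J s) (f s) -1# (f (suc s))

  qfall-difference : ∀ s a c → s ℕ.+ a ≤ c →
    pow q s * (qfall (suc c ∸ s) (suc a) + -1# * qfall (c ∸ s) (suc a)) ≈ pow q (c ∸ a) * qint (suc a) * qfall (c ∸ s) a
  qfall-difference s a c s+a≤c with NP.m≤n⇒∃[o]m+o≡n s+a≤c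
  ... | w , P.refl = begin
    pow q s * (qfall (suc C ∸ s) (suc a) + -1# * qfall x (suc a))
      ≡⟨ P.cong (λ z → pow q s * (qfall z (suc a) + -1# * qfall x (suc a))) (NP.+-∸-assoc 1 (NP.m+n≤o⇒m≤o s s+a≤c)) ⟩
    pow q s * (qfall (suc x) (suc a) + -1# * qfall x (suc a))
      ≈⟨ *-congˡ (+-cong (qfall-suc (suc x) a) (*-congˡ (qfall-snoc x a))) ⟩
    pow q s * (qint (suc x) * qfall x a + -1# * (qfall x a * qint (x ∸ a)))
      ≈⟨ *-congˡ (+-congʳ (*-congʳ (trans (reflexive (P.cong qint suc-x)) (qint-+ (x ∸ a) (suc a))))) ⟩
    pow q s * ((qint (x ∸ a) + pow q (x ∸ a) * qint (suc a)) * qfall x a + -1# * (qfall x a * qint (x ∸ a)))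
      ≈⟨ solve 6 (λ qs I Qx Ia F E → qs :* ((I :+ Qx :* Ia) :* F :+ E :* (F :* I)) := (qs :* F) :* (I :+ E :* I) :+ (qs :* Qx) :* Ia :* F)
           refl (pow q s) (qint (x ∸ a)) (pow q (x ∸ a)) (qint (suc a)) (qfall x a) -1# ⟩
    (pow q s * qfall x a) * (qint (x ∸ a) + -1# * qint (x ∸ a)) + (pow q s * pow q (x ∸ a)) * qint (suc a) * qfall x a
      ≈⟨ +-cong (trans (*-congˡ (x+-1x≈0 _)) (zeroʳ _))
           (*-congʳ (*-congʳ (trans (sym (pow-+ q s (x ∸ a))) (reflexive (P.cong (pow q) s+x∸a))))) ⟩
    0# + pow q (C ∸ a) * qint (suc a) * qfall x a
      ≈⟨ +-identityˡ _ ⟩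
    pow q (C ∸ a) * qint (suc a) * qfall x a ∎
    where
    C = s ℕ.+ a ℕ.+ w
    x = C ∸ s
    x≡a+w : x ≡ a ℕ.+ w
    x≡a+w = P.trans (P.cong (_∸ s) (NP.+-assoc s a w)) (NP.m+n∸m≡n s (a ℕ.+ w))
    x∸a≡w : x ∸ a ≡ w
    x∸a≡w = P.trans (P.cong (_∸ a) x≡a+w) (NP.m+n∸m≡n a w)
    suc-x : suc x ≡ (x ∸ a) ℕ.+ suc a
    suc-x = P.trans (P.cong suc x≡a+w) (P.trans (rearrange₁ a w) (P.cong (ℕ._+ suc a) (P.sym x∸a≡w)))
      where
      rearrange₁ : ∀ a w → suc (a ℕ.+ w) ≡ w ℕ.+ suc a
      rearrange₁ = NS.solve-∀
    s+x∸a : s ℕ.+ (x ∸ a) ≡ C ∸ a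
    s+x∸a = P.trans (P.cong (s ℕ.+_) x∸a≡w) (P.sym (m+n≡o⇒o∸m≡n a (rearrange₂ s a w)))
      where
      rearrange₂ : ∀ s a w → a ℕ.+ (s ℕ.+ w) ≡ s ℕ.+ a ℕ.+ w
      rearrange₂ = NS.solve-∀

  Δ-qfall : ∀ J a c → J ℕ.+ a ≤ suc c → Δ J (λ s → qfall (c ∸ s) a) ≈ pow q (J ℕ.* (c ∸ a)) * qfall a J * qfall (c ∸ J) (a ∸ J)
  Δ-qfall zero a c _ = begin
    1# * 1# * qbinom 0 0 * qfall c a + 0#
      ≈⟨ +-identityʳ _ ⟩
    1# * 1# * qbinom 0 0 * qfall c a
      ≈⟨ *-congʳ (*-congˡ (qbinom-zeroʳ 0)) ⟩
    1# * 1# * 1# * qfall c a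
      ≈⟨ solve 1 (λ x → con 1 :* con 1 :* con 1 :* x := con 1 :* con 1 :* x) refl _ ⟩
    1# * 1# * qfall c a ∎
  Δ-qfall (suc J) zero c _ = begin
    Δ (suc J) (λ _ → 1#)
      ≈⟨ Δ-suc J (λ _ → 1#) ⟩
    Δ J (λ s → pow q s * (1# + -1# * 1#))
      ≈⟨ Δ-cong J (λ s _ → trans (*-congˡ (x+-1x≈0 1#)) (trans (zeroʳ (pow q s)) (sym (zeroˡ 1#)))) ⟩
    Δ J (λ _ → 0# * 1#)
      ≈⟨ Δ-*ˡ J 0# (λ _ → 1#) ⟨
    0# * Δ J (λ _ → 1#)
      ≈⟨ zeroˡ _ ⟩
    0#
      ≈⟨ trans (*-congʳ (trans (*-congˡ (qfall-vanish 0 (suc J) (s≤s z≤n))) (zeroʳ _))) (zeroˡ _) ⟨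
    pow q (suc J ℕ.* (c ∸ 0)) * qfall 0 (suc J) * qfall (c ∸ suc J) (0 ∸ suc J) ∎
  Δ-qfall (suc J) (suc a) zero (s≤s J+a+1≤0) with () ← P.subst (ℕ._≤ 0) (NP.+-suc J a) J+a+1≤0
  Δ-qfall (suc J) (suc a) (suc c) (s≤s J+a+1≤c+1) = begin
    Δ (suc J) (λ s → qfall (suc c ∸ s) (suc a))
      ≈⟨ Δ-suc J (λ s → qfall (suc c ∸ s) (suc a)) ⟩
    Δ J (λ s → pow q s * (qfall (suc c ∸ s) (suc a) + -1# * qfall (c ∸ s) (suc a)))
      ≈⟨ Δ-cong J (λ s s≤J → qfall-difference s a c (NP.≤-trans (NP.+-monoˡ-≤ a s≤J) J+a≤c)) ⟩
    Δ J (λ s → K * qfall (c ∸ s) a)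
      ≈⟨ Δ-*ˡ J K (λ s → qfall (c ∸ s) a) ⟨
    K * Δ J (λ s → qfall (c ∸ s) a)
      ≈⟨ *-congˡ (Δ-qfall J a c (NP.m≤n⇒m≤1+n J+a≤c)) ⟩
    K * (pow q (J ℕ.* (c ∸ a)) * qfall a J * qfall (c ∸ J) (a ∸ J))
      ≈⟨ solve 5 (λ A I B F G → (A :* I) :* (B :* F :* G) := (A :* B) :* (I :* F) :* G)
           refl (pow q (c ∸ a)) (qint (suc a)) (pow q (J ℕ.* (c ∸ a))) (qfall a J) (qfall (c ∸ J) (a ∸ J)) ⟩
    (pow q (c ∸ a) * pow q (J ℕ.* (c ∸ a))) * (qint (suc a) * qfall a J) * qfall (c ∸ J) (a ∸ J)
      ≈⟨ *-congʳ (*-cong (sym (pow-+ q (c ∸ a) (J ℕ.* (c ∸ a)))) (sym (qfall-suc (suc a) J))) ⟩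
    pow q (suc J ℕ.* (c ∸ a)) * qfall (suc a) (suc J) * qfall (c ∸ J) (a ∸ J) ∎
    where
    K = pow q (c ∸ a) * qint (suc a)
    J+a≤c : J ℕ.+ a ≤ c
    J+a≤c = NP.≤-pred (P.subst (ℕ._≤ suc c) (NP.+-suc J a) J+a+1≤c+1)

  Δ-weight-zero : ∀ J → Δ-weight J 0 ≈ 1#
  Δ-weight-zero J = trans (*-congˡ (qbinom-zeroʳ J)) (trans (*-identityʳ _) (*-identityˡ 1#))

  Δ-weight-vanish : ∀ J s → J < s → Δ-weight J s ≈ 0#
  Δ-weight-vanish J s J<s = trans (*-congˡ (qbinom-vanish J s J<s)) (zeroʳ _)

  Δ-qfall-split : ∀ a b J → J ≤ suc b →
    qfall (suc a ℕ.+ b) a * qint (suc b) + ∑ (suc b) (λ u → Δ-weight J (suc u) * qfall (suc a ℕ.+ b ∸ suc u) (suc a))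
      ≈ pow q (J ℕ.* b) * qfall (suc a) J * qfall (suc a ℕ.+ b ∸ J) (suc a ∸ J)
  Δ-qfall-split a b J J≤1+b = begin
    qfall C a * qint (suc b) + ∑ (suc b) (λ u → Δ-weight J (suc u) * f (suc u))
      ≈⟨ +-congʳ top-term ⟩
    ∑ (suc (suc b)) (λ s → Δ-weight J s * f s)
      ≈⟨ ∑-truncate J (suc b) (λ s → Δ-weight J s * f s) J≤1+b (λ s J<s → trans (*-congʳ (Δ-weight-vanish J s J<s)) (zeroˡ _)) ⟩
    Δ J f
      ≈⟨ Δ-qfall J (suc a) C (NP.≤-trans (NP.+-monoˡ-≤ (suc a) J≤1+b) (NP.≤-reflexive (rearrange a b))) ⟩
    pow q (J ℕ.* (C ∸ suc a)) * qfall (suc a) J * qfall (C ∸ J) (suc a ∸ J)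
      ≡⟨ P.cong (λ x → pow q (J ℕ.* x) * qfall (suc a) J * qfall (C ∸ J) (suc a ∸ J)) (NP.m+n∸m≡n (suc a) b) ⟩
    pow q (J ℕ.* b) * qfall (suc a) J * qfall (C ∸ J) (suc a ∸ J) ∎
    where
    C = suc a ℕ.+ b
    f : ℕ → Carrier
    f s = qfall (C ∸ s) (suc a)
    rearrange : ∀ a b → suc b ℕ.+ suc a ≡ suc (suc a ℕ.+ b)
    rearrange = NS.solve-∀
    top-term : qfall C a * qint (suc b) ≈ Δ-weight J 0 * f 0
    top-term = begin
      qfall C a * qint (suc b)
        ≡⟨ P.cong (λ x → qfall C a * qint x) (P.trans (P.cong (_∸ a) (P.sym (NP.+-suc a b))) (NP.m+n∸m≡n a (suc b))) ⟨
      qfall C a * qint (C ∸ a)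
        ≈⟨ qfall-snoc C a ⟨
      qfall C (suc a)
        ≈⟨ *-identityˡ _ ⟨
      1# * qfall C (suc a)
        ≈⟨ *-congʳ (Δ-weight-zero J) ⟨
      Δ-weight J 0 * f 0 ∎

  qbinom*qfact*qfactInv-ratio : ∀ a b J → J ≤ suc b → suc b ≤ a →
    qbinom a (suc b) * qfact (a ℕ.+ b ∸ J) * qfactInv (a ∸ J)
      ≈ qfall a J * qfall (a ℕ.+ b ∸ J) (a ∸ J) * bracketInv b * qfactInv (a ∸ suc b)
  qbinom*qfact*qfactInv-ratio a b J J≤1+b 1+b≤a = begin
    qfall a (suc b) * qfactInv (suc b) * qfact X * qfactInv (a ∸ J)
      ≈⟨ *-congʳ (*-cong (*-congʳ (qfall≈qfact*qfactInv a (suc b) 1+b≤a)) (sym (qfall*qfact X (a ∸ J) (NP.∸-monoˡ-≤ J (NP.m≤m+n a b))))) ⟩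
    qfact a * qfactInv (a ∸ suc b) * qfactInv (suc b) * (qfall X (a ∸ J) * qfact (X ∸ (a ∸ J))) * qfactInv (a ∸ J)
      ≡⟨ P.cong (λ x → qfact a * qfactInv (a ∸ suc b) * qfactInv (suc b) * (qfall X (a ∸ J) * qfact x) * qfactInv (a ∸ J)) X∸[a∸J]≡b ⟩
    qfact a * qfactInv (a ∸ suc b) * qfactInv (suc b) * (qfall X (a ∸ J) * qfact b) * qfactInv (a ∸ J)
      ≈⟨ solve 6 (λ fa fi fi′ l fb fj → fa :* fi :* fi′ :* (l :* fb) :* fj := fa :* fj :* l :* (fb :* fi′) :* fi) refl _ _ _ _ _ _ ⟩
    qfact a * qfactInv (a ∸ J) * qfall X (a ∸ J) * (qfact b * qfactInv (suc b)) * qfactInv (a ∸ suc b)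
      ≈⟨ *-congʳ (*-cong (*-congʳ (sym (qfall≈qfact*qfactInv a J J≤a))) (qfact*qfactInv-suc b)) ⟩
    qfall a J * qfall X (a ∸ J) * bracketInv b * qfactInv (a ∸ suc b) ∎
    where
    X = a ℕ.+ b ∸ J
    J≤a = NP.≤-trans J≤1+b 1+b≤a
    X∸[a∸J]≡b : X ∸ (a ∸ J) ≡ b
    X∸[a∸J]≡b = P.trans (P.cong (_∸ (a ∸ J)) (NP.+-∸-comm b J≤a)) (NP.m+n∸m≡n (a ∸ J) b)

  qbinom-Δ-identity : ∀ a b J → J ≤ suc b → b ≤ a →
    qbinom (suc a) (suc b) * qfact (suc a ℕ.+ b ∸ J) * qfactInv (suc a ∸ J) * pow q (b ℕ.* J)
      ≈ qfall (suc a ℕ.+ b) a * qfactInv (a ∸ b)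
        + ∑ (suc b) (λ u → bracketInv b * qfactInv (a ∸ b) * (Δ-weight J (suc u) * qfall (suc a ℕ.+ b ∸ suc u) (suc a)))
  qbinom-Δ-identity a b J J≤1+b b≤a = begin
    qbinom (suc a) (suc b) * qfact (C ∸ J) * qfactInv (suc a ∸ J) * pow q (b ℕ.* J)
      ≈⟨ *-congʳ (qbinom*qfact*qfactInv-ratio (suc a) b J J≤1+b (s≤s b≤a)) ⟩
    qfall (suc a) J * qfall (C ∸ J) (suc a ∸ J) * bi * fi * pow q (b ℕ.* J)
      ≈⟨ solve 5 (λ x y i j e → x :* y :* i :* j :* e := i :* j :* (e :* x :* y)) refl _ _ bi fi _ ⟩
    bi * fi * (pow q (b ℕ.* J) * qfall (suc a) J * qfall (C ∸ J) (suc a ∸ J))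
      ≡⟨ P.cong (λ x → bi * fi * (pow q x * qfall (suc a) J * qfall (C ∸ J) (suc a ∸ J))) (NP.*-comm b J) ⟩
    bi * fi * (pow q (J ℕ.* b) * qfall (suc a) J * qfall (C ∸ J) (suc a ∸ J))
      ≈⟨ *-congˡ (Δ-qfall-split a b J J≤1+b) ⟨
    bi * fi * (qfall C a * qint (suc b) + ∑ (suc b) g)
      ≈⟨ distribˡ (bi * fi) _ _ ⟩
    bi * fi * (qfall C a * qint (suc b)) + bi * fi * ∑ (suc b) g
      ≈⟨ +-cong main-term (∑-*ˡ (suc b) (bi * fi) g) ⟩
    qfall C a * fi + ∑ (suc b) (λ u → bi * fi * g u) ∎
    where
    C = suc a ℕ.+ b
    bi = bracketInv b
    fi = qfactInv (a ∸ b)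
    g : ℕ → Carrier
    g u = Δ-weight J (suc u) * qfall (C ∸ suc u) (suc a)
    main-term : bi * fi * (qfall C a * qint (suc b)) ≈ qfall C a * fi
    main-term = begin
      bi * fi * (qfall C a * qint (suc b))
        ≈⟨ solve 4 (λ i j x y → i :* j :* (x :* y) := x :* j :* (y :* i)) refl bi fi _ _ ⟩
      qfall C a * fi * (qint (suc b) * bi)
        ≈⟨ *-congˡ (bracket-inv b) ⟩
      qfall C a * fi * 1#
        ≈⟨ *-identityʳ _ ⟩
      qfall C a * fi ∎

  coeff-xqPoch*qbinom : ∀ r s J →
    coeff (xqPoch (r ℕ.+ J)) (r ℕ.+ s) * qbinom (r ℕ.+ s) r
      ≈ pow q (r ℕ.* s) * (pow -1# r * pow q (binom2 r) * qbinom (r ℕ.+ J) r) * Δ-weight J s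
  coeff-xqPoch*qbinom r s J = begin
    coeff (xqPoch t) j * qbinom j r
      ≈⟨ *-congʳ (coeff-xqPoch t j) ⟩
    pow -1# j * pow q (binom2 j) * qbinom t j * qbinom j r
      ≈⟨ *-assoc _ _ _ ⟩
    pow -1# j * pow q (binom2 j) * (qbinom t j * qbinom j r)
      ≈⟨ *-cong (*-cong (pow-+ -1# r s) q^binom2-j) (qbinom-trinomial t j r (NP.m≤m+n r s)) ⟩
    pow -1# r * pow -1# s * (pow q (binom2 r) * pow q (binom2 s) * pow q (r ℕ.* s)) * (qbinom t r * qbinom (t ∸ r) (j ∸ r))
      ≡⟨ P.cong₂ (λ x y → pow -1# r * pow -1# s * (pow q (binom2 r) * pow q (binom2 s) * pow q (r ℕ.* s)) * (qbinom t r * qbinom x y))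
           (NP.m+n∸m≡n r J) (NP.m+n∸m≡n r s) ⟩
    pow -1# r * pow -1# s * (pow q (binom2 r) * pow q (binom2 s) * pow q (r ℕ.* s)) * (qbinom t r * qbinom J s)
      ≈⟨ solve 7 (λ σr σs cr cs e B B′ → σr :* σs :* (cr :* cs :* e) :* (B :* B′) := e :* (σr :* cr :* B) :* (σs :* cs :* B′))
           refl _ _ _ _ _ _ _ ⟩
    pow q (r ℕ.* s) * (pow -1# r * pow q (binom2 r) * qbinom t r) * Δ-weight J s ∎
    where
    t = r ℕ.+ J
    j = r ℕ.+ s
    q^binom2-j : pow q (binom2 j) ≈ pow q (binom2 r) * pow q (binom2 s) * pow q (r ℕ.* s)
    q^binom2-j = begin
      pow q (binom2 j)                                         ≡⟨ P.cong (pow q) (binom2-+ r s) ⟩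
      pow q (binom2 r ℕ.+ binom2 s ℕ.+ r ℕ.* s)                ≈⟨ pow-+ q (binom2 r ℕ.+ binom2 s) (r ℕ.* s) ⟩
      pow q (binom2 r ℕ.+ binom2 s) * pow q (r ℕ.* s)          ≈⟨ *-congʳ (pow-+ q (binom2 r) (binom2 s)) ⟩
      pow q (binom2 r) * pow q (binom2 s) * pow q (r ℕ.* s)    ∎

module HNumbers {c ℓ} (S : QSetting c ℓ) where
  open QOps S hiding (zero)
  open CommutativeRingLemmas cring
  open Binom2Properties S
  open QCalculus S
  open NCS commutativeSemiring using (solve; _:=_; _:+_; _:*_)
  open SetoidReasoning setoid

  weight : ℕ → ℕ → Carrier
  weight M t = qfact (M ∸ t) * pow -1# t * pow q (M ℕ.* t ∸ binom2 t)

  kernel : ℕ → ℕ → ℕ → Carrier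
  kernel M i t = weight M t * coeff (xqPoch t) i

  ⟨_∣_⟩ : List ℕ → (ℕ → Carrier) → Carrier
  ⟨ lam ∣ g ⟩ = pow qinv (size lam) * ∑ (suc (len lam)) (λ t → R t lam * g t)

  R-vanish : ∀ lam t → len lam < t → R t lam ≈ 0#
  R-vanish lam t len<t = reflexive (P.cong (λ ps → sumC (map (λ p → pow q (inv lam p)) ps)) (placements-len< lam len<t))

  ⟨∣⟩-cong : ∀ lam {g h} → (∀ t → t ≤ len lam → g t ≈ h t) → ⟨ lam ∣ g ⟩ ≈ ⟨ lam ∣ h ⟩
  ⟨∣⟩-cong lam {g} {h} g≈h = *-congˡ (∑-cong (suc (len lam)) {λ t → R t lam * g t} {λ t → R t lam * h t}
    (λ t t<1+len → *-congˡ (g≈h t (NP.≤-pred t<1+len))))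

  ⟨∣⟩-*ˡ : ∀ lam x g → x * ⟨ lam ∣ g ⟩ ≈ ⟨ lam ∣ (λ t → x * g t) ⟩
  ⟨∣⟩-*ˡ lam x g = begin
    x * (Q * ∑ (suc (len lam)) (λ t → R t lam * g t))
      ≈⟨ solve 3 (λ a b c → a :* (b :* c) := b :* (a :* c)) refl x Q _ ⟩
    Q * (x * ∑ (suc (len lam)) (λ t → R t lam * g t))
      ≈⟨ *-congˡ (∑-*ˡ (suc (len lam)) x (λ t → R t lam * g t)) ⟩
    Q * ∑ (suc (len lam)) (λ t → x * (R t lam * g t))
      ≈⟨ *-congˡ (∑-cong (suc (len lam)) (λ t _ →
           solve 3 (λ a b c → a :* (b :* c) := b :* (a :* c)) refl x (R t lam) (g t))) ⟩
    ⟨ lam ∣ (λ t → x * g t) ⟩ ∎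
    where
    Q = pow qinv (size lam)

  ⟨∣⟩-+ : ∀ lam g h → ⟨ lam ∣ (λ t → g t + h t) ⟩ ≈ ⟨ lam ∣ g ⟩ + ⟨ lam ∣ h ⟩
  ⟨∣⟩-+ lam g h = trans (*-congˡ (trans (∑-cong (suc (len lam)) (λ t _ → distribˡ (R t lam) (g t) (h t)))
                                        (∑-+ (suc (len lam)) (λ t → R t lam * g t) (λ t → R t lam * h t))))
                        (distribˡ _ _ _)

  ⟨∣⟩-∑ : ∀ lam n (g : ℕ → ℕ → Carrier) → ⟨ lam ∣ (λ t → ∑ n (λ u → g u t)) ⟩ ≈ ∑ n (λ u → ⟨ lam ∣ g u ⟩)
  ⟨∣⟩-∑ lam n g = begin
    Q * ∑ (suc (len lam)) (λ t → R t lam * ∑ n (λ u → g u t))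
      ≈⟨ *-congˡ (∑-cong (suc (len lam)) (λ t _ → ∑-*ˡ n (R t lam) (λ u → g u t))) ⟩
    Q * ∑ (suc (len lam)) (λ t → ∑ n (λ u → R t lam * g u t))
      ≈⟨ *-congˡ (∑-comm (suc (len lam)) n (λ t u → R t lam * g u t)) ⟩
    Q * ∑ n (λ u → ∑ (suc (len lam)) (λ t → R t lam * g u t))
      ≈⟨ ∑-*ˡ n Q _ ⟩
    ∑ n (λ u → ⟨ lam ∣ g u ⟩) ∎
    where
    Q = pow qinv (size lam)

  H≈⟨qfactInv*kernel⟩ : ∀ M N i lam → len lam ≤ N → H M N i lam ≈ ⟨ lam ∣ (λ t → qfactInv (M ∸ N) * kernel M i t) ⟩
  H≈⟨qfactInv*kernel⟩ M N i lam len≤N = begin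
    Q * F * coeff (Hgen M N lam) i
      ≈⟨ *-congˡ (coeff-foldr-⊕ (suc N) (λ t → scale (R t lam * qfact (M ∸ t) * pow -1# t * pow q (M ℕ.* t ∸ binom2 t)) (xqPoch t)) i) ⟩
    Q * F * ∑ (suc N) (λ t → coeff (scale (R t lam * qfact (M ∸ t) * pow -1# t * pow q (M ℕ.* t ∸ binom2 t)) (xqPoch t)) i)
      ≈⟨ *-congˡ (∑-cong (suc N) (λ t _ → trans (coeff-scale _ (xqPoch t) i) (regroup t))) ⟩
    Q * F * ∑ (suc N) (λ t → R t lam * kernel M i t)
      ≈⟨ *-congˡ (∑-truncate (len lam) N (λ t → R t lam * kernel M i t) len≤N
           (λ t len<t → trans (*-congʳ (R-vanish lam t len<t)) (zeroˡ _))) ⟩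
    Q * F * ∑ (suc (len lam)) (λ t → R t lam * kernel M i t)
      ≈⟨ *-assoc Q F _ ⟩
    Q * (F * ∑ (suc (len lam)) (λ t → R t lam * kernel M i t))
      ≈⟨ *-congˡ (∑-*ˡ (suc (len lam)) F (λ t → R t lam * kernel M i t)) ⟩
    Q * ∑ (suc (len lam)) (λ t → F * (R t lam * kernel M i t))
      ≈⟨ *-congˡ (∑-cong (suc (len lam)) (λ t _ → solve 3 (λ f x y → f :* (x :* y) := x :* (f :* y)) refl F (R t lam) (kernel M i t))) ⟩
    ⟨ lam ∣ (λ t → F * kernel M i t) ⟩ ∎
    where
    Q = pow qinv (size lam)
    F = qfactInv (M ∸ N)
    regroup : ∀ t → R t lam * qfact (M ∸ t) * pow -1# t * pow q (M ℕ.* t ∸ binom2 t) * coeff (xqPoch t) i ≈ R t lam * kernel M i t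
    regroup t = solve 5 (λ a b c d f → a :* b :* c :* d :* f := a :* (b :* c :* d :* f))
      refl (R t lam) (qfact (M ∸ t)) (pow -1# t) (pow q (M ℕ.* t ∸ binom2 t)) (coeff (xqPoch t) i)

  Hsq≈⟨kernel⟩ : ∀ N i lam → len lam ≤ N → Hsq N i lam ≈ ⟨ lam ∣ kernel N i ⟩
  Hsq≈⟨kernel⟩ N i lam len≤N = trans (H≈⟨qfactInv*kernel⟩ N N i lam len≤N)
    (⟨∣⟩-cong lam {λ t → qfactInv (N ∸ N) * kernel N i t} {kernel N i}
      (λ t _ → trans (*-congʳ (reflexive (P.cong qfactInv (NP.n∸n≡0 N)))) (*-identityˡ (kernel N i t))))

  kernel-vanish : ∀ M i t → t < i → kernel M i t ≈ 0#
  kernel-vanish M i t t<i = begin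
    weight M t * coeff (xqPoch t) i                          ≈⟨ *-congˡ (coeff-xqPoch t i) ⟩
    weight M t * (pow -1# i * pow q (binom2 i) * qbinom t i) ≈⟨ *-congˡ (*-congˡ (qbinom-vanish t i t<i)) ⟩
    weight M t * (pow -1# i * pow q (binom2 i) * 0#)         ≈⟨ trans (*-congˡ (zeroʳ _)) (zeroʳ _) ⟩
    0#                                                       ∎

  weight-shift : ∀ M x t → t ≤ M → weight (M ℕ.+ x) t ≈ qfact (M ℕ.+ x ∸ t) * qfactInv (M ∸ t) * pow q (x ℕ.* t) * weight M t
  weight-shift M x t t≤M = begin
    F′ * pow -1# t * pow q ((M ℕ.+ x) ℕ.* t ∸ binom2 t)
      ≡⟨ P.cong (λ e → F′ * pow -1# t * pow q e) exponent ⟩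
    F′ * pow -1# t * pow q (M ℕ.* t ∸ binom2 t ℕ.+ x ℕ.* t)
      ≈⟨ *-congˡ (pow-+ q (M ℕ.* t ∸ binom2 t) (x ℕ.* t)) ⟩
    F′ * pow -1# t * (pow q (M ℕ.* t ∸ binom2 t) * pow q (x ℕ.* t))
      ≈⟨ *-identityʳ _ ⟨
    F′ * pow -1# t * (pow q (M ℕ.* t ∸ binom2 t) * pow q (x ℕ.* t)) * 1#
      ≈⟨ *-congˡ (qfactInv*qfact (M ∸ t)) ⟨
    F′ * pow -1# t * (pow q (M ℕ.* t ∸ binom2 t) * pow q (x ℕ.* t)) * (qfactInv (M ∸ t) * qfact (M ∸ t))
      ≈⟨ solve 6 (λ f′ σ e x fi f → f′ :* σ :* (e :* x) :* (fi :* f) := f′ :* fi :* x :* (f :* σ :* e))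
           refl F′ (pow -1# t) (pow q (M ℕ.* t ∸ binom2 t)) (pow q (x ℕ.* t)) (qfactInv (M ∸ t)) (qfact (M ∸ t)) ⟩
    F′ * qfactInv (M ∸ t) * pow q (x ℕ.* t) * weight M t ∎
    where
    F′ = qfact (M ℕ.+ x ∸ t)
    exponent : (M ℕ.+ x) ℕ.* t ∸ binom2 t ≡ M ℕ.* t ∸ binom2 t ℕ.+ x ℕ.* t
    exponent = P.trans (P.cong (_∸ binom2 t) (NP.*-distribʳ-+ t M x)) (NP.+-∸-comm (x ℕ.* t) (binom2≤* M t t≤M))

  kernel-first-diagonal : ∀ m n k → k ≤ n → n ≤ m →
    qbinom (m ∸ k) (n ∸ k) * kernel (m ℕ.+ n ∸ k) k k
      ≈ pow q (k ℕ.* (n ∸ k)) * qfall (m ℕ.+ n ∸ 2 ℕ.* k) (m ∸ k) * (qfactInv (m ∸ n) * kernel m k k)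
  kernel-first-diagonal m n k k≤n n≤m with NP.m≤n⇒∃[o]m+o≡n k≤n | NP.m≤n⇒∃[o]m+o≡n n≤m
  ... | b , P.refl | d , P.refl = begin
    qbinom (m ∸ k) (n ∸ k) * (weight (m ℕ.+ n ∸ k) k * ct)
      ≡⟨ P.cong₂ (λ x y → qbinom x (n ∸ k) * (weight y k * ct)) m∸k≡a (P.trans (NP.+-∸-assoc m k≤n) (P.cong (m ℕ.+_) n∸k≡b)) ⟩
    qbinom a (n ∸ k) * (weight (m ℕ.+ b) k * ct)
      ≈⟨ *-congˡ (*-congʳ (weight-shift m b k k≤m)) ⟩
    qbinom a (n ∸ k) * (qfact (m ℕ.+ b ∸ k) * qfactInv (m ∸ k) * pow q (b ℕ.* k) * weight m k * ct)
      ≡⟨ P.cong₂ (λ x y → qbinom a x * (qfact y * qfactInv (m ∸ k) * pow q (b ℕ.* k) * weight m k * ct)) n∸k≡b m+b∸k≡a+b ⟩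
    qbinom a b * (qfact (a ℕ.+ b) * qfactInv (m ∸ k) * pow q (b ℕ.* k) * weight m k * ct)
      ≡⟨ P.cong (λ x → qbinom a b * (qfact (a ℕ.+ b) * qfactInv x * pow q (b ℕ.* k) * weight m k * ct)) m∸k≡a ⟩
    qbinom a b * (qfact (a ℕ.+ b) * qfactInv a * pow q (b ℕ.* k) * weight m k * ct)
      ≈⟨ solve 6 (λ B f fi e w c → B :* (f :* fi :* e :* w :* c) := B :* f :* fi :* e :* (w :* c)) refl _ _ _ _ _ _ ⟩
    qbinom a b * qfact (a ℕ.+ b) * qfactInv a * pow q (b ℕ.* k) * kernel m k k
      ≈⟨ *-congʳ (*-congʳ (qbinom*qfact*qfactInv a b (NP.m≤m+n b d))) ⟩
    qfall (a ℕ.+ b) a * qfactInv (a ∸ b) * pow q (b ℕ.* k) * kernel m k k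
      ≈⟨ solve 4 (λ f i e x → f :* i :* e :* x := e :* f :* (i :* x)) refl _ _ _ _ ⟩
    pow q (b ℕ.* k) * qfall (a ℕ.+ b) a * (qfactInv (a ∸ b) * kernel m k k)
      ≡⟨ P.cong₂ (λ x y → pow q x * qfall (a ℕ.+ b) a * (qfactInv y * kernel m k k))
           (P.trans (NP.*-comm b k) (P.cong (k ℕ.*_) (P.sym n∸k≡b))) (P.sym m∸n≡a∸b) ⟩
    pow q (k ℕ.* (n ∸ k)) * qfall (a ℕ.+ b) a * (qfactInv (m ∸ n) * kernel m k k)
      ≡⟨ P.cong₂ (λ x y → pow q (k ℕ.* (n ∸ k)) * qfall x y * (qfactInv (m ∸ n) * kernel m k k)) (P.sym m+n∸2k≡a+b) (P.sym m∸k≡a) ⟩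
    pow q (k ℕ.* (n ∸ k)) * qfall (m ℕ.+ n ∸ 2 ℕ.* k) (m ∸ k) * (qfactInv (m ∸ n) * kernel m k k) ∎
    where
    a = b ℕ.+ d
    ct = coeff (xqPoch k) k
    k≤m = NP.≤-trans k≤n n≤m
    m∸k≡a : m ∸ k ≡ a
    m∸k≡a = m+n≡o⇒o∸m≡n k (P.sym (NP.+-assoc k b d))
    n∸k≡b : n ∸ k ≡ b
    n∸k≡b = NP.m+n∸m≡n k b
    m+b∸k≡a+b : m ℕ.+ b ∸ k ≡ a ℕ.+ b
    m+b∸k≡a+b = m+n≡o⇒o∸m≡n k (rearrange k b d)
      where
      rearrange : ∀ k b d → k ℕ.+ (b ℕ.+ d ℕ.+ b) ≡ k ℕ.+ b ℕ.+ d ℕ.+ b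
      rearrange = NS.solve-∀
    m+n∸2k≡a+b : m ℕ.+ n ∸ 2 ℕ.* k ≡ a ℕ.+ b
    m+n∸2k≡a+b = m+n≡o⇒o∸m≡n (2 ℕ.* k) (rearrange k b d)
      where
      rearrange : ∀ k b d → 2 ℕ.* k ℕ.+ (b ℕ.+ d ℕ.+ b) ≡ k ℕ.+ b ℕ.+ d ℕ.+ (k ℕ.+ b)
      rearrange = NS.solve-∀
    m∸n≡a∸b : m ∸ n ≡ a ∸ b
    m∸n≡a∸b = P.trans (NP.m+n∸m≡n n d) (P.sym (NP.m+n∸m≡n b d))

  kernel-first : ∀ m n k t → k ≤ n → n ≤ m → t ≤ k →
    qbinom (m ∸ k) (n ∸ k) * kernel (m ℕ.+ n ∸ k) k t
      ≈ pow q (k ℕ.* (n ∸ k)) * qfall (m ℕ.+ n ∸ 2 ℕ.* k) (m ∸ k) * (qfactInv (m ∸ n) * kernel m k t)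
  kernel-first m n k t k≤n n≤m t≤k with NP.m≤n⇒m<n∨m≡n t≤k
  ... | inj₂ P.refl = kernel-first-diagonal m n k k≤n n≤m
  ... | inj₁ t<k = begin
    qbinom (m ∸ k) (n ∸ k) * kernel (m ℕ.+ n ∸ k) k t
      ≈⟨ trans (*-congˡ (kernel-vanish _ k t t<k)) (zeroʳ _) ⟩
    0#
      ≈⟨ trans (*-congˡ (trans (*-congˡ (kernel-vanish m k t t<k)) (zeroʳ _))) (zeroʳ _) ⟨
    pow q (k ℕ.* (n ∸ k)) * qfall (m ℕ.+ n ∸ 2 ℕ.* k) (m ∸ k) * (qfactInv (m ∸ n) * kernel m k t) ∎

  first-identity : ∀ m n lam → n ≤ m → len lam ≤ n →
    let k = len lam in
    qbinom (m ∸ k) (n ∸ k) * Hsq (m ℕ.+ n ∸ k) k lam ≈ pow q (k ℕ.* (n ∸ k)) * qfall (m ℕ.+ n ∸ 2 ℕ.* k) (m ∸ k) * H m n k lam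
  first-identity m n lam n≤m k≤n = begin
    B * Hsq N k lam
      ≈⟨ *-congˡ (Hsq≈⟨kernel⟩ N k lam k≤N) ⟩
    B * ⟨ lam ∣ kernel N k ⟩
      ≈⟨ ⟨∣⟩-*ˡ lam B (kernel N k) ⟩
    ⟨ lam ∣ (λ t → B * kernel N k t) ⟩
      ≈⟨ ⟨∣⟩-cong lam (λ t t≤k → kernel-first m n k t k≤n n≤m t≤k) ⟩
    ⟨ lam ∣ (λ t → A * (F * kernel m k t)) ⟩
      ≈⟨ ⟨∣⟩-*ˡ lam A (λ t → F * kernel m k t) ⟨
    A * ⟨ lam ∣ (λ t → F * kernel m k t) ⟩
      ≈⟨ *-congˡ (H≈⟨qfactInv*kernel⟩ m n k lam k≤n) ⟨
    A * H m n k lam ∎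
    where
    k = len lam
    N = m ℕ.+ n ∸ k
    B = qbinom (m ∸ k) (n ∸ k)
    A = pow q (k ℕ.* (n ∸ k)) * qfall (m ℕ.+ n ∸ 2 ℕ.* k) (m ∸ k)
    F = qfactInv (m ∸ n)
    k≤N : k ≤ N
    k≤N = NP.≤-trans (NP.≤-trans k≤n n≤m) (NP.≤-trans (NP.m≤m+n m (n ∸ k)) (NP.≤-reflexive (P.sym (NP.+-∸-assoc m k≤n))))

  secondCoefficient : ℕ → ℕ → ℕ → ℕ → Carrier
  secondCoefficient m n r j =
    qpowℤ (+ r ℤ.* (+ n ℤ.- + 1 ℤ.- + j)) * qbinom j r * qfall (m ℕ.+ n ∸ r ∸ j ∸ 1) (m ∸ r) * qintInv (n ∸ r)

  -- With n = r+1+b, m = n+d and t = r+J, each term of kernel-second is q^{rb} W times the matching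
  -- term of qbinom-Δ-identity at a = b+d (so that m-r = a+1 and n-r = b+1).
  module SecondKernelTerms (r b d J : ℕ) where
    n = suc r ℕ.+ b
    m = n ℕ.+ d
    t = r ℕ.+ J
    a = b ℕ.+ d

    W : Carrier
    W = weight m t * (pow -1# r * pow q (binom2 r) * qbinom t r)

    m∸r≡1+a : m ∸ r ≡ suc a
    m∸r≡1+a = m+n≡o⇒o∸m≡n r (rearrange r b d)
      where
      rearrange : ∀ r b d → r ℕ.+ suc (b ℕ.+ d) ≡ suc r ℕ.+ b ℕ.+ d
      rearrange = NS.solve-∀

    n∸r≡1+b : n ∸ r ≡ suc b
    n∸r≡1+b = m+n≡o⇒o∸m≡n r (NP.+-suc r b)

    m∸n≡a∸b : m ∸ n ≡ a ∸ b
    m∸n≡a∸b = P.trans (NP.m+n∸m≡n n d) (P.sym (NP.m+n∸m≡n b d))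

    m+n∸r∸1≡m+b : m ℕ.+ n ∸ r ∸ 1 ≡ m ℕ.+ b
    m+n∸r∸1≡m+b = P.cong (_∸ 1) (m+n≡o⇒o∸m≡n r (rearrange r b d))
      where
      rearrange : ∀ r b d → r ℕ.+ suc (suc r ℕ.+ b ℕ.+ d ℕ.+ b) ≡ suc r ℕ.+ b ℕ.+ d ℕ.+ (suc r ℕ.+ b)
      rearrange = NS.solve-∀

    m+b∸t≡1+a+b∸J : m ℕ.+ b ∸ t ≡ suc a ℕ.+ b ∸ J
    m+b∸t≡1+a+b∸J = P.trans (P.cong (_∸ t) (rearrange r b d)) (NP.[m+n]∸[m+o]≡n∸o r (suc a ℕ.+ b) J)
      where
      rearrange : ∀ r b d → suc r ℕ.+ b ℕ.+ d ℕ.+ b ≡ r ℕ.+ (suc (b ℕ.+ d) ℕ.+ b)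
      rearrange = NS.solve-∀

    m∸t≡1+a∸J : m ∸ t ≡ suc a ∸ J
    m∸t≡1+a∸J = P.trans (P.cong (_∸ t) (rearrange r b d)) (NP.[m+n]∸[m+o]≡n∸o r (suc a) J)
      where
      rearrange : ∀ r b d → suc r ℕ.+ b ℕ.+ d ≡ r ℕ.+ suc (b ℕ.+ d)
      rearrange = NS.solve-∀

    m+n∸2r∸1≡1+a+b : m ℕ.+ n ∸ 2 ℕ.* r ∸ 1 ≡ suc a ℕ.+ b
    m+n∸2r∸1≡1+a+b = P.cong (_∸ 1) (m+n≡o⇒o∸m≡n (2 ℕ.* r) (rearrange r b d))
      where
      rearrange : ∀ r b d → 2 ℕ.* r ℕ.+ suc (suc (b ℕ.+ d) ℕ.+ b) ≡ suc r ℕ.+ b ℕ.+ d ℕ.+ (suc r ℕ.+ b)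
      rearrange = NS.solve-∀

    lhs : J ≤ suc b →
      qbinom (m ∸ r) (n ∸ r) * kernel (m ℕ.+ n ∸ r ∸ 1) r t
        ≈ pow q (r ℕ.* b) * W * (qbinom (suc a) (suc b) * qfact (suc a ℕ.+ b ∸ J) * qfactInv (suc a ∸ J) * pow q (b ℕ.* J))
    lhs J≤1+b = begin
      qbinom (m ∸ r) (n ∸ r) * (weight (m ℕ.+ n ∸ r ∸ 1) t * coeff (xqPoch t) r)
        ≡⟨ P.cong₂ (λ x y → qbinom x y * (weight (m ℕ.+ n ∸ r ∸ 1) t * coeff (xqPoch t) r)) m∸r≡1+a n∸r≡1+b ⟩
      qbinom (suc a) (suc b) * (weight (m ℕ.+ n ∸ r ∸ 1) t * coeff (xqPoch t) r)
        ≡⟨ P.cong (λ x → qbinom (suc a) (suc b) * (weight x t * coeff (xqPoch t) r)) m+n∸r∸1≡m+b ⟩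
      qbinom (suc a) (suc b) * (weight (m ℕ.+ b) t * coeff (xqPoch t) r)
        ≈⟨ *-congˡ (*-cong (weight-shift m b t t≤m) (coeff-xqPoch t r)) ⟩
      qbinom (suc a) (suc b) * (qfact (m ℕ.+ b ∸ t) * qfactInv (m ∸ t) * pow q (b ℕ.* t) * weight m t * Ct)
        ≡⟨ P.cong₂ (λ x y → qbinom (suc a) (suc b) * (qfact x * qfactInv y * pow q (b ℕ.* t) * weight m t * Ct)) m+b∸t≡1+a+b∸J m∸t≡1+a∸J ⟩
      qbinom (suc a) (suc b) * (qfact (suc a ℕ.+ b ∸ J) * qfactInv (suc a ∸ J) * pow q (b ℕ.* t) * weight m t * Ct)
        ≈⟨ *-congˡ (*-congʳ (*-congʳ (*-congˡ (trans (reflexive (P.cong (pow q) b*t≡r*b+b*J)) (pow-+ q (r ℕ.* b) (b ℕ.* J)))))) ⟩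
      qbinom (suc a) (suc b) * (qfact (suc a ℕ.+ b ∸ J) * qfactInv (suc a ∸ J) * (pow q (r ℕ.* b) * pow q (b ℕ.* J)) * weight m t * Ct)
        ≈⟨ solve 7 (λ B f fi e e′ w c → B :* (f :* fi :* (e :* e′) :* w :* c) := e :* (w :* c) :* (B :* f :* fi :* e′)) refl _ _ _ _ _ _ _ ⟩
      pow q (r ℕ.* b) * W * (qbinom (suc a) (suc b) * qfact (suc a ℕ.+ b ∸ J) * qfactInv (suc a ∸ J) * pow q (b ℕ.* J)) ∎
      where
      Ct = pow -1# r * pow q (binom2 r) * qbinom t r
      t≤m : t ≤ m
      t≤m = NP.≤-trans (NP.≤-trans (NP.+-monoʳ-≤ r J≤1+b) (NP.≤-reflexive (NP.+-suc r b))) (NP.m≤m+n n d)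
      b*t≡r*b+b*J : b ℕ.* t ≡ r ℕ.* b ℕ.+ b ℕ.* J
      b*t≡r*b+b*J = P.trans (NP.*-distribˡ-+ b r J) (P.cong (ℕ._+ b ℕ.* J) (NP.*-comm b r))

    main : pow q (r ℕ.* (n ∸ r ∸ 1)) * qfall (m ℕ.+ n ∸ 2 ℕ.* r ∸ 1) (m ∸ r ∸ 1) * (qfactInv (m ∸ n) * kernel m r t)
             ≈ pow q (r ℕ.* b) * W * (qfall (suc a ℕ.+ b) a * qfactInv (a ∸ b))
    main = begin
      pow q (r ℕ.* (n ∸ r ∸ 1)) * qfall (m ℕ.+ n ∸ 2 ℕ.* r ∸ 1) (m ∸ r ∸ 1) * (qfactInv (m ∸ n) * kernel m r t)
        ≡⟨ P.cong₂ (λ x y → pow q (r ℕ.* (x ∸ 1)) * qfall y (m ∸ r ∸ 1) * (qfactInv (m ∸ n) * kernel m r t)) n∸r≡1+b m+n∸2r∸1≡1+a+b ⟩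
      pow q (r ℕ.* b) * qfall (suc a ℕ.+ b) (m ∸ r ∸ 1) * (qfactInv (m ∸ n) * kernel m r t)
        ≡⟨ P.cong₂ (λ x y → pow q (r ℕ.* b) * qfall (suc a ℕ.+ b) (x ∸ 1) * (qfactInv y * kernel m r t)) m∸r≡1+a m∸n≡a∸b ⟩
      pow q (r ℕ.* b) * qfall (suc a ℕ.+ b) a * (qfactInv (a ∸ b) * (weight m t * coeff (xqPoch t) r))
        ≈⟨ *-congˡ (*-congˡ (*-congˡ (coeff-xqPoch t r))) ⟩
      pow q (r ℕ.* b) * qfall (suc a ℕ.+ b) a * (qfactInv (a ∸ b) * W)
        ≈⟨ solve 4 (λ e f i w → e :* f :* (i :* w) := e :* w :* (f :* i)) refl _ _ _ W ⟩
      pow q (r ℕ.* b) * W * (qfall (suc a ℕ.+ b) a * qfactInv (a ∸ b)) ∎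

    m+n∸r∸j∸1≡1+a+b∸1+u : ∀ u → m ℕ.+ n ∸ r ∸ (suc r ℕ.+ u) ∸ 1 ≡ suc a ℕ.+ b ∸ suc u
    m+n∸r∸j∸1≡1+a+b∸1+u u =
      P.trans (P.cong (λ x → x ∸ (suc r ℕ.+ u) ∸ 1) (m+n≡o⇒o∸m≡n r (rearrange r b d)))
      (P.trans (P.cong (_∸ 1) (NP.[m+n]∸[m+o]≡n∸o r (suc a ℕ.+ b) u))
      (P.trans (NP.∸-+-assoc (suc a ℕ.+ b) u 1) (P.cong (suc a ℕ.+ b ∸_) (NP.+-comm u 1))))
      where
      rearrange : ∀ r b d → r ℕ.+ suc (r ℕ.+ (suc (b ℕ.+ d) ℕ.+ b)) ≡ suc r ℕ.+ b ℕ.+ d ℕ.+ (suc r ℕ.+ b)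
      rearrange = NS.solve-∀

    exponent : ∀ u → u < b → + r ℤ.* (+ n ℤ.- + 1 ℤ.- + (suc r ℕ.+ u)) ≡ + (r ℕ.* (b ∸ suc u))
    exponent u u<b = P.trans (P.cong (λ z → + r ℤ.* (z ℤ.- + (suc r ℕ.+ u))) n-1≡r+b)
      (P.trans (P.cong (+ r ℤ.*_) (P.trans r+b-j≡r+b∸j (P.cong +_ r+b∸j≡b∸[1+u]))) (P.sym (ZP.pos-* r (b ∸ suc u))))
      where
      n-1≡r+b : + n ℤ.- + 1 ≡ + (r ℕ.+ b)
      n-1≡r+b = P.trans (ZP.m-n≡m⊖n n 1) (ZP.⊖-≥ (s≤s z≤n))
      r+b-j≡r+b∸j : + (r ℕ.+ b) ℤ.- + (suc r ℕ.+ u) ≡ + (r ℕ.+ b ∸ (suc r ℕ.+ u))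
      r+b-j≡r+b∸j = P.trans (ZP.m-n≡m⊖n (r ℕ.+ b) (suc r ℕ.+ u))
        (ZP.⊖-≥ (NP.≤-trans (NP.≤-reflexive (P.sym (NP.+-suc r u))) (NP.+-monoʳ-≤ r u<b)))
      r+b∸j≡b∸[1+u] : r ℕ.+ b ∸ (suc r ℕ.+ u) ≡ b ∸ suc u
      r+b∸j≡b∸[1+u] = P.trans (P.cong (r ℕ.+ b ∸_) (P.sym (NP.+-suc r u))) (NP.[m+n]∸[m+o]≡n∸o r b (suc u))

    top-vanish : qfall (suc a ℕ.+ b ∸ suc b) (suc a) ≈ 0#
    top-vanish = trans (reflexive (P.cong (λ x → qfall x (suc a)) (NP.m+n∸n≡m a b))) (qfall-vanish a (suc a) (NP.n<1+n a))

    term : ∀ u → u < suc b →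
      secondCoefficient m n r (suc r ℕ.+ u) * (qfactInv (m ∸ n) * kernel m (suc r ℕ.+ u) t)
        ≈ pow q (r ℕ.* b) * W * (bracketInv b * qfactInv (a ∸ b) * (Δ-weight J (suc u) * qfall (suc a ℕ.+ b ∸ suc u) (suc a)))
    term u u<1+b with NP.m≤n⇒m<n∨m≡n (NP.≤-pred u<1+b)
    -- j = n: the exponent r(n-1-j) is negative, but the factor [m-r-1]_{m-r} = 0 kills the term.
    ... | inj₂ P.refl = begin
      secondCoefficient m n r (suc r ℕ.+ b) * K
        ≈⟨ *-congʳ (*-congʳ (*-congˡ (trans (reflexive (P.cong₂ qfall (m+n∸r∸j∸1≡1+a+b∸1+u b) m∸r≡1+a)) top-vanish))) ⟩
      qpowℤ (+ r ℤ.* (+ n ℤ.- + 1 ℤ.- + (suc r ℕ.+ b))) * qbinom (suc r ℕ.+ b) r * 0# * qintInv (n ∸ r) * K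
        ≈⟨ trans (*-congʳ (trans (*-congʳ (zeroʳ _)) (zeroˡ _))) (zeroˡ _) ⟩
      0#
        ≈⟨ trans (*-congˡ (trans (*-congˡ (trans (*-congˡ top-vanish) (zeroʳ _))) (zeroʳ _))) (zeroʳ _) ⟨
      pow q (r ℕ.* b) * W * (bracketInv b * qfactInv (a ∸ b) * (Δ-weight J (suc b) * qfall (suc a ℕ.+ b ∸ suc b) (suc a))) ∎
      where
      K = qfactInv (m ∸ n) * kernel m (suc r ℕ.+ b) t
    ... | inj₁ u<b = begin
      secondCoefficient m n r j * (qfactInv (m ∸ n) * kernel m j t)
        ≡⟨ P.cong₂ (λ x y → x * (qfactInv y * kernel m j t)) coefficient≡ m∸n≡a∸b ⟩
      E * qbinom j r * qfall Y (suc a) * bracketInv b * (qfactInv (a ∸ b) * (weight m t * coeff (xqPoch t) j))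
        ≈⟨ solve 7 (λ e B f bi fi w c → e :* B :* f :* bi :* (fi :* (w :* c)) := e :* (c :* B) :* w :* (bi :* fi :* f))
             refl _ _ _ _ _ _ _ ⟩
      E * (coeff (xqPoch t) j * qbinom j r) * weight m t * F
        ≡⟨ P.cong (λ x → E * (coeff (xqPoch t) x * qbinom x r) * weight m t * F) (P.sym (NP.+-suc r u)) ⟩
      E * (coeff (xqPoch t) (r ℕ.+ suc u) * qbinom (r ℕ.+ suc u) r) * weight m t * F
        ≈⟨ *-congʳ (*-congʳ (*-congˡ (coeff-xqPoch*qbinom r (suc u) J))) ⟩
      E * (pow q (r ℕ.* suc u) * Ct * Δ-weight J (suc u)) * weight m t * F
        ≈⟨ solve 8 (λ e e′ c δ w bi fi f → e :* (e′ :* c :* δ) :* w :* (bi :* fi :* f) := (e :* e′) :* (w :* c) :* (bi :* fi :* (δ :* f)))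
             refl _ _ _ _ _ _ _ _ ⟩
      E * pow q (r ℕ.* suc u) * W * (bracketInv b * qfactInv (a ∸ b) * (Δ-weight J (suc u) * qfall Y (suc a)))
        ≈⟨ *-congʳ (*-congʳ E*q^[r*[1+u]]≈q^[r*b]) ⟩
      pow q (r ℕ.* b) * W * (bracketInv b * qfactInv (a ∸ b) * (Δ-weight J (suc u) * qfall Y (suc a))) ∎
      where
      j = suc r ℕ.+ u
      Y = suc a ℕ.+ b ∸ suc u
      E = pow q (r ℕ.* (b ∸ suc u))
      F = bracketInv b * qfactInv (a ∸ b) * qfall Y (suc a)
      Ct = pow -1# r * pow q (binom2 r) * qbinom t r
      coefficient≡ : secondCoefficient m n r j ≡ E * qbinom j r * qfall Y (suc a) * bracketInv b
      coefficient≡ = P.trans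
        (P.cong₂ (λ x y → qpowℤ x * qbinom j r * qfall y (m ∸ r) * qintInv (n ∸ r)) (exponent u u<b) (m+n∸r∸j∸1≡1+a+b∸1+u u))
        (P.cong₂ (λ x y → E * qbinom j r * qfall Y x * qintInv y) m∸r≡1+a n∸r≡1+b)
      E*q^[r*[1+u]]≈q^[r*b] : E * pow q (r ℕ.* suc u) ≈ pow q (r ℕ.* b)
      E*q^[r*[1+u]]≈q^[r*b] = trans (sym (pow-+ q (r ℕ.* (b ∸ suc u)) (r ℕ.* suc u)))
        (reflexive (P.cong (pow q) (P.trans (P.sym (NP.*-distribˡ-+ r (b ∸ suc u) (suc u))) (P.cong (r ℕ.*_) (NP.m∸n+n≡m u<b)))))

  kernel-second : ∀ m n r t → r < n → n ≤ m → t ≤ n →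
    qbinom (m ∸ r) (n ∸ r) * kernel (m ℕ.+ n ∸ r ∸ 1) r t
      ≈ pow q (r ℕ.* (n ∸ r ∸ 1)) * qfall (m ℕ.+ n ∸ 2 ℕ.* r ∸ 1) (m ∸ r ∸ 1) * (qfactInv (m ∸ n) * kernel m r t)
        + ∑ (n ∸ r) (λ u → secondCoefficient m n r (suc r ℕ.+ u) * (qfactInv (m ∸ n) * kernel m (suc r ℕ.+ u) t))
  kernel-second m n r t r<n n≤m t≤n with NP.≤-<-connex r t
  ... | inj₂ t<r = begin
    qbinom (m ∸ r) (n ∸ r) * kernel (m ℕ.+ n ∸ r ∸ 1) r t
      ≈⟨ trans (*-congˡ (kernel-vanish _ r t t<r)) (zeroʳ _) ⟩
    0#
      ≈⟨ +-identityʳ 0# ⟨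
    0# + 0#
      ≈⟨ +-cong (trans (*-congˡ (trans (*-congˡ (kernel-vanish m r t t<r)) (zeroʳ _))) (zeroʳ _))
           (∑-zero (n ∸ r) (λ u _ → trans (*-congˡ (trans (*-congˡ (kernel-vanish m (suc r ℕ.+ u) t (t<j u))) (zeroʳ _))) (zeroʳ _))) ⟨
    _ ∎
    where
    t<j : ∀ u → t < suc r ℕ.+ u
    t<j u = NP.<-≤-trans t<r (NP.≤-trans (NP.n≤1+n r) (NP.m≤m+n (suc r) u))
  ... | inj₁ r≤t with NP.m≤n⇒∃[o]m+o≡n r≤t | NP.m≤n⇒∃[o]m+o≡n r<n | NP.m≤n⇒∃[o]m+o≡n n≤m
  ... | J , P.refl | b , P.refl | d , P.refl = begin
    qbinom (m ∸ r) (n ∸ r) * kernel (m ℕ.+ n ∸ r ∸ 1) r t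
      ≈⟨ lhs J≤1+b ⟩
    K * (qbinom (suc a) (suc b) * qfact (suc a ℕ.+ b ∸ J) * qfactInv (suc a ∸ J) * pow q (b ℕ.* J))
      ≈⟨ *-congˡ (qbinom-Δ-identity a b J J≤1+b (NP.m≤m+n b d)) ⟩
    K * (qfall (suc a ℕ.+ b) a * qfactInv (a ∸ b) + ∑ (suc b) reduced-term)
      ≈⟨ trans (distribˡ K _ _) (+-congˡ (∑-*ˡ (suc b) K reduced-term)) ⟩
    K * (qfall (suc a ℕ.+ b) a * qfactInv (a ∸ b)) + ∑ (suc b) (λ u → K * reduced-term u)
      ≈⟨ +-cong (sym main) (∑-cong (suc b) (λ u u<1+b → sym (term u u<1+b))) ⟩
    pow q (r ℕ.* (n ∸ r ∸ 1)) * qfall (m ℕ.+ n ∸ 2 ℕ.* r ∸ 1) (m ∸ r ∸ 1) * (qfactInv (m ∸ n) * kernel m r t)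
      + ∑ (suc b) (λ u → secondCoefficient m n r (suc r ℕ.+ u) * (qfactInv (m ∸ n) * kernel m (suc r ℕ.+ u) t))
      ≡⟨ P.cong (λ x → pow q (r ℕ.* (n ∸ r ∸ 1)) * qfall (m ℕ.+ n ∸ 2 ℕ.* r ∸ 1) (m ∸ r ∸ 1) * (qfactInv (m ∸ n) * kernel m r t)
           + ∑ x (λ u → secondCoefficient m n r (suc r ℕ.+ u) * (qfactInv (m ∸ n) * kernel m (suc r ℕ.+ u) t))) (P.sym n∸r≡1+b) ⟩
    pow q (r ℕ.* (n ∸ r ∸ 1)) * qfall (m ℕ.+ n ∸ 2 ℕ.* r ∸ 1) (m ∸ r ∸ 1) * (qfactInv (m ∸ n) * kernel m r t)
      + ∑ (n ∸ r) (λ u → secondCoefficient m n r (suc r ℕ.+ u) * (qfactInv (m ∸ n) * kernel m (suc r ℕ.+ u) t)) ∎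
    where
    open SecondKernelTerms r b d J using (W; a; n∸r≡1+b; lhs; main; term)
    K = pow q (r ℕ.* b) * W
    reduced-term : ℕ → Carrier
    reduced-term u = bracketInv b * qfactInv (a ∸ b) * (Δ-weight J (suc u) * qfall (suc a ℕ.+ b ∸ suc u) (suc a))
    J≤1+b : J ≤ suc b
    J≤1+b = NP.+-cancelˡ-≤ r J (suc b) (NP.≤-trans t≤n (NP.≤-reflexive (P.sym (NP.+-suc r b))))

  second-identity : ∀ m n lam r → n ≤ m → len lam ≤ n → r < len lam →
    qbinom (m ∸ r) (n ∸ r) * Hsq (m ℕ.+ n ∸ r ∸ 1) r lam
      ≈ pow q (r ℕ.* (n ∸ r ∸ 1)) * qfall (m ℕ.+ n ∸ 2 ℕ.* r ∸ 1) (m ∸ r ∸ 1) * H m n r lam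
        + sumRange (suc r) n (λ j → secondCoefficient m n r j * H m n j lam)
  second-identity m n lam r n≤m k≤n r<k = begin
    B * Hsq N r lam
      ≈⟨ *-congˡ (Hsq≈⟨kernel⟩ N r lam (NP.≤-trans k≤n n≤N)) ⟩
    B * ⟨ lam ∣ kernel N r ⟩
      ≈⟨ ⟨∣⟩-*ˡ lam B (kernel N r) ⟩
    ⟨ lam ∣ (λ t → B * kernel N r t) ⟩
      ≈⟨ ⟨∣⟩-cong lam (λ t t≤k → kernel-second m n r t r<n n≤m (NP.≤-trans t≤k k≤n)) ⟩
    ⟨ lam ∣ (λ t → A * (F * kernel m r t) + ∑ (n ∸ r) (λ u → coeffᵤ u * (F * kernel m (j u) t))) ⟩
      ≈⟨ ⟨∣⟩-+ lam (λ t → A * (F * kernel m r t)) (λ t → ∑ (n ∸ r) (λ u → coeffᵤ u * (F * kernel m (j u) t))) ⟩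
    ⟨ lam ∣ (λ t → A * (F * kernel m r t)) ⟩ + ⟨ lam ∣ (λ t → ∑ (n ∸ r) (λ u → coeffᵤ u * (F * kernel m (j u) t))) ⟩
      ≈⟨ +-cong (sym (⟨∣⟩-*ˡ lam A (λ t → F * kernel m r t))) (⟨∣⟩-∑ lam (n ∸ r) (λ u t → coeffᵤ u * (F * kernel m (j u) t))) ⟩
    A * ⟨ lam ∣ (λ t → F * kernel m r t) ⟩ + ∑ (n ∸ r) (λ u → ⟨ lam ∣ (λ t → coeffᵤ u * (F * kernel m (j u) t)) ⟩)
      ≈⟨ +-congˡ (∑-cong (n ∸ r) (λ u _ → sym (⟨∣⟩-*ˡ lam (coeffᵤ u) (λ t → F * kernel m (j u) t)))) ⟩
    A * ⟨ lam ∣ (λ t → F * kernel m r t) ⟩ + ∑ (n ∸ r) (λ u → coeffᵤ u * ⟨ lam ∣ (λ t → F * kernel m (j u) t) ⟩)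
      ≈⟨ +-cong (*-congˡ (sym (H≈⟨qfactInv*kernel⟩ m n r lam k≤n)))
           (∑-cong (n ∸ r) (λ u _ → *-congˡ (sym (H≈⟨qfactInv*kernel⟩ m n (j u) lam k≤n)))) ⟩
    A * H m n r lam + ∑ (n ∸ r) (λ u → coeffᵤ u * H m n (j u) lam) ∎
    where
    N = m ℕ.+ n ∸ r ∸ 1
    B = qbinom (m ∸ r) (n ∸ r)
    A = pow q (r ℕ.* (n ∸ r ∸ 1)) * qfall (m ℕ.+ n ∸ 2 ℕ.* r ∸ 1) (m ∸ r ∸ 1)
    F = qfactInv (m ∸ n)
    j : ℕ → ℕ
    j u = suc r ℕ.+ u
    coeffᵤ : ℕ → Carrier
    coeffᵤ u = secondCoefficient m n r (j u)
    r<n = NP.<-≤-trans r<k k≤n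
    n≤N : n ≤ N
    n≤N = P.subst (n ≤_) (P.trans (P.sym (NP.+-∸-comm n (NP.≤-trans r<n n≤m)))
            (P.trans (P.cong (m ℕ.+ n ∸_) (NP.+-comm 1 r)) (P.sym (NP.∸-+-assoc (m ℕ.+ n) r 1))))
            (NP.m≤n+m n (m ∸ suc r))

-- Only ℓ(λ) ≤ n is used: the identities hold for any list of row lengths.
lemma5p5 : ∀ {c ℓ} (S : QSetting c ℓ) (m n : ℕ) (lam : List ℕ) →
    n ≤ m → IsPartition lam → InsideBoard n m lam →
    let open QOps S
        k = len lam
    in (qbinom (m ∸ k) (n ∸ k) * Hsq (m ℕ.+ n ∸ k) k lam
          ≈ pow q (k ℕ.* (n ∸ k)) * qfall (m ℕ.+ n ∸ 2 ℕ.* k) (m ∸ k) * H m n k lam)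
       × (∀ r → r < k →
          qbinom (m ∸ r) (n ∸ r) * Hsq (m ℕ.+ n ∸ r ∸ 1) r lam
            ≈ pow q (r ℕ.* (n ∸ r ∸ 1)) * qfall (m ℕ.+ n ∸ 2 ℕ.* r ∸ 1) (m ∸ r ∸ 1) * H m n r lam
              + sumRange (suc r) n (λ j →
                  qpowℤ (+ r ℤ.* (+ n ℤ.- + 1 ℤ.- + j)) * qbinom j r
                    * qfall (m ℕ.+ n ∸ r ∸ j ∸ 1) (m ∸ r) * qintInv (n ∸ r) * H m n j lam))
lemma5p5 S m n lam n≤m _ (len≤n , _) =
  first-identity m n lam n≤m len≤n , λ r r<len → second-identity m n lam r n≤m len≤n r<len
  where open HNumbers S
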